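{- Let $G$ be a finite connected graph (loops and multiple edges allowed) of maximal degree $d$ and girth $g$ with $n$ vertices, where $g<\infty$. Then \[ \kappa(G) \leq \frac{n d (d-1)^{\lfloor g/2 \rfloor}}{g}, \] with equality if and only if $G$ is a Moore graph.
   Context: Graphs are multigraphs: loops and multiple edges are allowed. A walk is a finite sequence of oriented edges in which the initial vertex of each edge after the first equals the terminal vertex of the previous one; it is closed if it starts and ends at the same vertex, and closed walks are considered up to cyclic permutation of their edge sequence. A cycle is a closed walk in which each vertex is the initial vertex of at most one edge of the walk. A walk is geodesic if it never traverses an edge and immediately retraverses it in the opposite direction; a closed geodesic is a closed walk that is locally geodesic (including across the starting point). The girth $g$ of $G$ is the smallest length of a closed geodesic in $G$. The kissing number $\kappa(G)$ is the number of distinct shortest oriented cycles in $G$ (oriented cycles of length $g$). A Moore graph is a connected $d$-regular graph of girth $g$ whose number of vertices equals $1 + d \sum_{j=0}^{(g-3)/2} (d-1)^j$ if $g$ is odd, or $2 \sum_{j=0}^{(g-2)/2} (d-1)^j$ if $g$ is even (the minimum possible for a $d$-regular graph of girth $g$). -}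

module Defs where

open import Data.Nat using (ℕ; zero; suc; _+_; _*_; _∸_; _^_; _≤_; ⌊_/2⌋)
open import Data.Nat.DivMod using (_mod_)
open import Data.Fin using (Fin; toℕ; _≟_)
open import Data.Bool using (Bool; true; false; not; if_then_else_)
open import Data.Product using (Σ; ∃; _×_; _,_; proj₁; proj₂)
open import Data.List using (List; []; _∷_; length; filter; concatMap; allFin)
open import Data.Vec using (Vec; lookup)
open import Relation.Binary.PropositionalEquality using (_≡_; _≢_)
open import Relation.Nullary using (¬_)
open import Function.Definitions using (Injective)

-- A finite multigraph (loops and multiple edges allowed):
-- vertices Fin nV, edges Fin nE, each edge has two (ordered, arbitrary) endpoints.
record Graph : Set where
  field
    nV   : ℕ
    nE   : ℕ
    ends : Fin nE → Fin nV × Fin nV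
open Graph public

Vertex : Graph → Set
Vertex G = Fin (nV G)

-- Oriented edges: an edge together with one of its two orientations.
-- (A loop therefore has two distinct orientations.)
OEdge : Graph → Set
OEdge G = Fin (nE G) × Bool

init : (G : Graph) → OEdge G → Vertex G
init G (e , false) = proj₁ (ends G e)
init G (e , true)  = proj₂ (ends G e)

term : (G : Graph) → OEdge G → Vertex G
term G (e , false) = proj₂ (ends G e)
term G (e , true)  = proj₁ (ends G e)

rev : (G : Graph) → OEdge G → OEdge G
rev G (e , b) = (e , not b)

allOEdges : (G : Graph) → List (OEdge G)
allOEdges G = concatMap (λ e → (e , false) ∷ (e , true) ∷ []) (allFin (nE G))

-- degree = number of oriented edges starting at v (a loop contributes 2)
deg : (G : Graph) → Vertex G → ℕ
deg G v = length (filter (λ o → init G o ≟ v) (allOEdges G))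

IsMaxDegree : Graph → ℕ → Set
IsMaxDegree G d = (∀ v → deg G v ≤ d) × ∃ (λ v → deg G v ≡ d)

IsRegular : Graph → ℕ → Set
IsRegular G d = ∀ v → deg G v ≡ d

data Walk (G : Graph) : Vertex G → Vertex G → Set where
  nil  : ∀ {u} → Walk G u u
  cons : ∀ {v} (o : OEdge G) → Walk G (term G o) v → Walk G (init G o) v

Connected : Graph → Set
Connected G = ∀ (u v : Vertex G) → Walk G u v

next : ∀ {L} → Fin L → Fin L
next {suc k} i = (toℕ i + 1) mod (suc k)

rot : ∀ {L} → Fin L → Fin L → Fin L
rot {suc k} r i = (toℕ i + toℕ r) mod (suc k)

IsClosedWalk : (G : Graph) (L : ℕ) → (Fin L → OEdge G) → Set
IsClosedWalk G L w = ∀ i → term G (w i) ≡ init G (w (next i))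

-- locally geodesic, including across the starting point
IsClosedGeodesic : (G : Graph) (L : ℕ) → (Fin L → OEdge G) → Set
IsClosedGeodesic G L w = IsClosedWalk G L w × (∀ i → w (next i) ≢ rev G (w i))

IsCycle : (G : Graph) (L : ℕ) → (Fin L → OEdge G) → Set
IsCycle G L w = IsClosedWalk G L w × Injective _≡_ _≡_ (λ i → init G (w i))

-- girth g: smallest (positive) length of a closed geodesic; g < ∞ means one exists
IsGirth : Graph → ℕ → Set
IsGirth G g = (1 ≤ g)
  × Σ (Fin g → OEdge G) (IsClosedGeodesic G g)
  × (∀ L (w : Fin L → OEdge G) → 1 ≤ L → IsClosedGeodesic G L w → g ≤ L)

IsShortestCycle : (G : Graph) (g : ℕ) → (Fin g → OEdge G) → Set
IsShortestCycle G g w = IsCycle G g w × IsClosedGeodesic G g w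

CycEquiv : (G : Graph) (L : ℕ) → (Fin L → OEdge G) → (Fin L → OEdge G) → Set
CycEquiv G L w w' = ∃ (λ (r : Fin L) → ∀ i → w' i ≡ w (rot r i))

-- κ(G) = k : there are exactly k classes (up to cyclic permutation) of shortest oriented cycles
IsKissingNumber : (G : Graph) (g k : ℕ) → Set
IsKissingNumber G g k =
  Σ (Vec (Fin g → OEdge G) k) λ cs →
      (∀ j → IsShortestCycle G g (lookup cs j))
    × (∀ i j → i ≢ j → ¬ CycEquiv G g (lookup cs i) (lookup cs j))
    × (∀ w → IsShortestCycle G g w → ∃ (λ j → CycEquiv G g (lookup cs j) w))

geomSum : ℕ → ℕ → ℕ
geomSum x zero    = 0
geomSum x (suc t) = geomSum x t + x ^ t

isOdd : ℕ → Bool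
isOdd zero    = false
isOdd (suc n) = not (isOdd n)

-- Moore vertex count:
--   g odd  (g = 2t+1): 1 + d Σ_{j=0}^{(g-3)/2} (d-1)^j = 1 + d Σ_{j<t} (d-1)^j
--   g even (g = 2t+2): 2 Σ_{j=0}^{(g-2)/2} (d-1)^j   = 2 Σ_{j<t+1} (d-1)^j
-- in both cases the upper summation bound (exclusive) is ⌊g/2⌋.
mooreCount : ℕ → ℕ → ℕ
mooreCount d g = if isOdd g then 1 + d * geomSum (d ∸ 1) ⌊ g /2⌋
                            else 2 * geomSum (d ∸ 1) ⌊ g /2⌋

IsMooreGraph : Graph → Set
IsMooreGraph G = Connected G × Σ ℕ λ d → Σ ℕ λ g →
  IsRegular G d × IsGirth G g × (nV G ≡ mooreCount d g)

-- Write h = ⌊ g /2⌋. A shortest oriented cycle read from any of its g starting points begins with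
-- a reduced (non-backtracking) walk of h + 1 edges, and this walk determines both the cycle and the
-- starting point: two distinct reduced walks with the same endpoints have total length at least g.
-- Hence g κ is at most the number of reduced walks with h + 1 edges, which is at most n d (d - 1)^h.
-- Equality holds exactly when G is d-regular and every such walk closes up into a shortest cycle.
-- In that case the reduced walks of length at most ⌊ (g - 1) /2⌋ into a vertex (g odd), or into
-- either end of an edge (g even), reach every vertex exactly once, which is the Moore count;
-- conversely, in a Moore graph these walks reach every vertex, so every reduced walk with h + 1
-- edges can be closed up into a shortest cycle.

module Submission where

open import Defs
open import Data.Nat using (ℕ; zero; suc; _+_; _*_; _∸_; _^_; _≤_; _<_; z≤n; s≤s; NonZero; >-nonZero; ⌊_/2⌋; _≤?_)
open import Data.Nat.Properties
open import Data.Nat.DivMod using (_%_; _mod_; m<n⇒m%n≡m; n%n≡0; m%n<n; %-distribˡ-+; m%n%n≡m%n; [m+n]%n≡m%n)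
open import Algebra.Properties.CommutativeSemigroup +-commutativeSemigroup
  using () renaming (interchange to +-interchange; x∙yz≈y∙xz to +-left-comm)
open import Data.Fin using (Fin; toℕ; fromℕ<; punchOut; remQuot; combine) renaming (zero to fz; suc to fs)
import Data.Fin.Properties as Fin
open import Data.Bool using (Bool; true; false; not)
import Data.Bool.Properties as Bool
open import Data.Maybe using (just; maybe′)
open import Data.Product using (Σ; ∃; _×_; _,_; proj₁; proj₂; uncurry)
import Data.Product.Properties as Product
open import Data.Sum using (_⊎_; inj₁; inj₂)
import Data.Sum as Sum
import Data.Sum.Properties as Sum
open import Data.Unit using (⊤; tt)
open import Data.Empty using (⊥)
open import Data.List using (List; []; _∷_; [_]; length; _++_; _∷ʳ_; filter; map; concatMap; allFin; lookup; last; take; drop; initLast; _∷ʳ′_)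
import Data.List.Properties as List
open import Data.List.Membership.Propositional using (_∈_; find; lose)
open import Data.List.Membership.Propositional.Properties
  using (∈-allFin; ∈-lookup; ∈-filter⁺; ∈-filter⁻; ∈-map⁺; ∈-map⁻; ∈-++⁺ˡ; ∈-++⁺ʳ; ∈-++⁻; ∈-concatMap⁺; ∈-concatMap⁻)
open import Data.List.Relation.Unary.Any using (here; there; index)
open import Data.List.Relation.Unary.Any.Properties using (lookup-index)
open import Data.List.Relation.Unary.All using ([]; _∷_)
import Data.List.Relation.Unary.All as All
open import Data.List.Relation.Unary.AllPairs using ([]; _∷_)
open import Data.List.Relation.Unary.Unique.Propositional using (Unique)
import Data.List.Relation.Unary.Unique.Propositional.Properties as Unique
import Data.Vec as Vec
open import Function using (_∘_; case_of_)
open import Function.Bundles using (_⇔_; mk⇔)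
open import Function.Definitions using (Injective)
open import Level using (0ℓ)
open import Relation.Nullary using (¬_; Dec; yes; no; contradiction; ¬?)
open import Relation.Nullary.Decidable using (_×-dec_; map′)
open import Relation.Unary using (Pred; Decidable)
open import Relation.Binary.Definitions using (DecidableEquality; tri<; tri≈; tri>)
open import Relation.Binary.PropositionalEquality hiding ([_])

indicator : ∀ {A : Set} → Dec A → ℕ
indicator (yes _) = 1
indicator (no _)  = 0

∑ : (n : ℕ) → (Fin n → ℕ) → ℕ
∑ zero    f = 0
∑ (suc n) f = f fz + ∑ n (λ i → f (fs i))

∑-cong : ∀ n {f g : Fin n → ℕ} → (∀ i → f i ≡ g i) → ∑ n f ≡ ∑ n g
∑-cong zero    f≗g = refl
∑-cong (suc n) f≗g = cong₂ _+_ (f≗g fz) (∑-cong n (λ i → f≗g (fs i)))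

∑-distrib-+ : ∀ n (f g : Fin n → ℕ) → ∑ n (λ i → f i + g i) ≡ ∑ n f + ∑ n g
∑-distrib-+ zero    f g = refl
∑-distrib-+ (suc n) f g = trans (cong (f fz + g fz +_) (∑-distrib-+ n _ _)) (+-interchange (f fz) (g fz) _ _)

∑-const : ∀ n d → ∑ n (λ _ → d) ≡ n * d
∑-const zero    d = refl
∑-const (suc n) d = cong (d +_) (∑-const n d)

∑-indicator : ∀ n (a : Fin n) → ∑ n (λ i → indicator (a Fin.≟ i)) ≡ 1
∑-indicator (suc n) fz     = cong suc (trans (∑-const n 0) (*-zeroʳ n))
∑-indicator (suc n) (fs a) = trans (∑-cong n indicator-suc) (∑-indicator n a)
  where
  indicator-suc : ∀ i → indicator (fs a Fin.≟ fs i) ≡ indicator (a Fin.≟ i)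
  indicator-suc i with a Fin.≟ i
  ... | yes _ = refl
  ... | no _  = refl

∑-≤ : ∀ n (f : Fin n → ℕ) d → (∀ i → f i ≤ d) → ∑ n f ≤ n * d
∑-≤ zero    f d f≤d = z≤n
∑-≤ (suc n) f d f≤d = +-mono-≤ (f≤d fz) (∑-≤ n _ d (λ i → f≤d (fs i)))

∑-≡-*⇒≡ : ∀ n (f : Fin n → ℕ) d → (∀ i → f i ≤ d) → ∑ n f ≡ n * d → ∀ i → f i ≡ d
∑-≡-*⇒≡ (suc n) f d f≤d eq fz = ≤-antisym (f≤d fz)
  (+-cancelʳ-≤ _ d (f fz) (≤-trans (+-monoʳ-≤ d (∑-≤ n _ d (λ i → f≤d (fs i)))) (≤-reflexive (sym eq))))
∑-≡-*⇒≡ (suc n) f d f≤d eq (fs i) = ∑-≡-*⇒≡ n _ d (λ i → f≤d (fs i)) tail-eq i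
  where
  tail-eq : ∑ n (λ i → f (fs i)) ≡ n * d
  tail-eq = ≤-antisym (∑-≤ n _ d (λ i → f≤d (fs i)))
    (+-cancelˡ-≤ d _ _ (≤-trans (≤-reflexive (sym eq)) (+-monoˡ-≤ _ (f≤d fz))))

module _ {A : Set} where

  length-filter-∷ : ∀ {P : Pred A 0ℓ} (P? : Decidable P) x xs →
                    length (filter P? (x ∷ xs)) ≡ indicator (P? x) + length (filter P? xs)
  length-filter-∷ P? x xs with P? x
  ... | yes _ = refl
  ... | no _  = refl

  length-filter-cong : ∀ {P Q : Pred A 0ℓ} (P? : Decidable P) (Q? : Decidable Q) →
                       (∀ x → P x → Q x) → (∀ x → Q x → P x) →
                       ∀ xs → length (filter P? xs) ≡ length (filter Q? xs)
  length-filter-cong P? Q? P⇒Q Q⇒P []       = refl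
  length-filter-cong {P} {Q} P? Q? P⇒Q Q⇒P (x ∷ xs) = begin
    length (filter P? (x ∷ xs))              ≡⟨ length-filter-∷ P? x xs ⟩
    indicator (P? x) + length (filter P? xs) ≡⟨ cong₂ _+_ (same (P? x) (Q? x)) (length-filter-cong P? Q? P⇒Q Q⇒P xs) ⟩
    indicator (Q? x) + length (filter Q? xs) ≡⟨ length-filter-∷ Q? x xs ⟨
    length (filter Q? (x ∷ xs))              ∎
    where
    open ≡-Reasoning
    same : (p : Dec (P x)) (q : Dec (Q x)) → indicator p ≡ indicator q
    same (yes _)  (yes _)  = refl
    same (yes px) (no ¬qx) = contradiction (P⇒Q x px) ¬qx
    same (no ¬px) (yes qx) = contradiction (Q⇒P x qx) ¬px
    same (no _)   (no _)   = refl

  ∑-length-fibres : ∀ n (f : A → Fin n) xs →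
                    ∑ n (λ v → length (filter (λ x → f x Fin.≟ v) xs)) ≡ length xs
  ∑-length-fibres n f []       = trans (∑-const n 0) (*-zeroʳ n)
  ∑-length-fibres n f (x ∷ xs) = begin
    ∑ n (λ v → length (filter (λ y → f y Fin.≟ v) (x ∷ xs)))
      ≡⟨ ∑-cong n (λ v → length-filter-∷ (λ y → f y Fin.≟ v) x xs) ⟩
    ∑ n (λ v → indicator (f x Fin.≟ v) + length (filter (λ y → f y Fin.≟ v) xs))
      ≡⟨ ∑-distrib-+ n _ _ ⟩
    ∑ n (λ v → indicator (f x Fin.≟ v)) + ∑ n (λ v → length (filter (λ y → f y Fin.≟ v) xs))
      ≡⟨ cong₂ _+_ (∑-indicator n (f x)) (∑-length-fibres n f xs) ⟩
    suc (length xs) ∎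
    where open ≡-Reasoning

  module _ (_≟_ : DecidableEquality A) where

    length-filter-≟-unique : ∀ {y} xs → Unique xs → y ∈ xs → length (filter (_≟ y) xs) ≡ 1
    length-filter-≟-unique (x ∷ xs) (x∉xs ∷ xs!) (here refl) with x ≟ x
    ... | no x≢x = contradiction refl x≢x
    ... | yes _  = cong suc (cong length (List.filter-none (_≟ x) (All.map (λ x≢ → x≢ ∘ sym) x∉xs)))
    length-filter-≟-unique {y} (x ∷ xs) (x∉xs ∷ xs!) (there y∈xs) with x ≟ y
    ... | no _     = length-filter-≟-unique xs xs! y∈xs
    ... | yes refl = contradiction y∈xs (Unique.Unique[x∷xs]⇒x∉xs (x∉xs ∷ xs!))

    length-filter-remove : ∀ {P : Pred A 0ℓ} (P? : Decidable P) y → P y → ∀ xs →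
      length (filter P? xs) ≡ length (filter (λ x → P? x ×-dec ¬? (x ≟ y)) xs) + length (filter (_≟ y) xs)
    length-filter-remove P? y py []       = refl
    length-filter-remove {P} P? y py (x ∷ xs) = begin
      length (filter P? (x ∷ xs))                        ≡⟨ length-filter-∷ P? x xs ⟩
      indicator (P? x) + length (filter P? xs)           ≡⟨ cong (indicator (P? x) +_) (length-filter-remove P? y py xs) ⟩
      indicator (P? x) + (m + n)                         ≡⟨ shuffle (P? x) (x ≟ y) ⟩
      indicator (P? x ×-dec ¬? (x ≟ y)) + m + (indicator (x ≟ y) + n)
        ≡⟨ cong₂ _+_ (length-filter-∷ (λ x → P? x ×-dec ¬? (x ≟ y)) x xs) (length-filter-∷ (_≟ y) x xs) ⟨
      length (filter (λ x → P? x ×-dec ¬? (x ≟ y)) (x ∷ xs)) + length (filter (_≟ y) (x ∷ xs)) ∎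
      where
      open ≡-Reasoning
      m = length (filter (λ x → P? x ×-dec ¬? (x ≟ y)) xs)
      n = length (filter (_≟ y) xs)
      shuffle : (p : Dec (P x)) (e : Dec (x ≡ y)) → indicator p + (m + n) ≡ indicator (p ×-dec ¬? e) + m + (indicator e + n)
      shuffle (yes _)  (yes _)    = sym (+-suc m n)
      shuffle (yes _)  (no _)     = refl
      shuffle (no ¬py) (yes refl) = contradiction py ¬py
      shuffle (no _)   (no _)     = refl

lookup-injective : ∀ {A : Set} {xs : List A} → Unique xs → Injective _≡_ _≡_ (lookup xs)
lookup-injective {xs = x ∷ xs} xs!        {fz}   {fz}   _  = refl
lookup-injective {xs = x ∷ xs} (x∉ ∷ xs!) {fz}   {fs j} eq =
  contradiction (subst (_∈ xs) (sym eq) (∈-lookup j)) (Unique.Unique[x∷xs]⇒x∉xs (x∉ ∷ xs!))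
lookup-injective {xs = x ∷ xs} (x∉ ∷ xs!) {fs i} {fz}   eq =
  contradiction (subst (_∈ xs) eq (∈-lookup i)) (Unique.Unique[x∷xs]⇒x∉xs (x∉ ∷ xs!))
lookup-injective {xs = x ∷ xs} (_ ∷ xs!)  {fs i} {fs j} eq = cong fs (lookup-injective xs! eq)

injective⇒surjective : ∀ {m n} (f : Fin m → Fin n) → Injective _≡_ _≡_ f → n ≤ m → ∀ y → ∃ λ i → f i ≡ y
injective⇒surjective {m} {suc n} f f-inj n≤m y with Fin.any? (λ i → f i Fin.≟ y)
... | yes hit = hit
... | no miss = contradiction (Fin.injective⇒≤ f′-injective) (<⇒≱ n≤m)
  where
  f′ : Fin m → Fin n
  f′ i = punchOut (λ fi≡y → miss (i , sym fi≡y))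
  f′-injective : Injective _≡_ _≡_ f′
  f′-injective {i} {j} eq = f-inj (Fin.punchOut-injective {i = y} (λ fi≡y → miss (i , sym fi≡y)) (λ fj≡y → miss (j , sym fj≡y)) eq)

module _ {A : Set} {n} (f : A → Fin n) where

  surjectiveOn⇒≤length : ∀ xs → (∀ v → ∃ λ x → x ∈ xs × f x ≡ v) → n ≤ length xs
  surjectiveOn⇒≤length xs hit = Fin.injective⇒≤ {f = position} position-injective
    where
    position : Fin n → Fin (length xs)
    position v = index (proj₁ (proj₂ (hit v)))
    position-injective : Injective _≡_ _≡_ position
    position-injective {v} {w} eq = begin
      v                                        ≡⟨ proj₂ (proj₂ (hit v)) ⟨
      f (proj₁ (hit v))                        ≡⟨ cong f (lookup-index (proj₁ (proj₂ (hit v)))) ⟩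
      f (lookup xs (position v))               ≡⟨ cong (f ∘ lookup xs) eq ⟩
      f (lookup xs (position w))               ≡⟨ cong f (lookup-index (proj₁ (proj₂ (hit w)))) ⟨
      f (proj₁ (hit w))                        ≡⟨ proj₂ (proj₂ (hit w)) ⟩
      w                                        ∎
      where open ≡-Reasoning

module _ {A : Set} {n} {xs : List A} (xs! : Unique xs) (f : ∀ {x} → x ∈ xs → Fin n)
         (f-inj : ∀ {x y} (p : x ∈ xs) (q : y ∈ xs) → f p ≡ f q → x ≡ y) where

  private
    f∘lookup : Fin (length xs) → Fin n
    f∘lookup i = f (∈-lookup i)

    f∘lookup-injective : Injective _≡_ _≡_ f∘lookup
    f∘lookup-injective eq = lookup-injective xs! (f-inj (∈-lookup _) (∈-lookup _) eq)

  injectiveOn⇒length≤ : length xs ≤ n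
  injectiveOn⇒length≤ = Fin.injective⇒≤ f∘lookup-injective

  injectiveOn⇒surjective : n ≤ length xs → ∀ v → ∃ λ x → Σ (x ∈ xs) λ x∈ → f x∈ ≡ v
  injectiveOn⇒surjective n≤ v =
    let i , fi≡v = injective⇒surjective f∘lookup f∘lookup-injective n≤ v in lookup xs i , ∈-lookup i , fi≡v

module _ {A : Set} {m} (h : Fin m → A) (h-inj : Injective _≡_ _≡_ h) {ys : List A} (h∈ys : ∀ i → h i ∈ ys) where

  private
    position : Fin m → Fin (length ys)
    position i = index (h∈ys i)

    position-injective : Injective _≡_ _≡_ position
    position-injective eq = h-inj (trans (lookup-index (h∈ys _)) (trans (cong (lookup ys) eq) (sym (lookup-index (h∈ys _)))))

  injection⇒≤length : m ≤ length ys
  injection⇒≤length = Fin.injective⇒≤ position-injective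

  injection⇒surjective : length ys ≤ m → ∀ {y} → y ∈ ys → ∃ λ i → h i ≡ y
  injection⇒surjective ys≤m y∈ys =
    let i , pos≡ = injective⇒surjective position position-injective ys≤m (index y∈ys)
    in i , trans (lookup-index (h∈ys i)) (trans (cong (lookup ys) pos≡) (sym (lookup-index y∈ys)))

module _ {A B : Set} (f : A → List B) where

  ∈-concatMap⁺′ : ∀ {x y xs} → x ∈ xs → y ∈ f x → y ∈ concatMap f xs
  ∈-concatMap⁺′ x∈xs y∈fx = ∈-concatMap⁺ f (lose x∈xs y∈fx)

  ∈-concatMap⁻′ : ∀ {y} xs → y ∈ concatMap f xs → ∃ λ x → x ∈ xs × y ∈ f x
  ∈-concatMap⁻′ xs y∈ = find (∈-concatMap⁻ f y∈)

  length-concatMap-≤ : ∀ k xs → (∀ x → x ∈ xs → length (f x) ≤ k) → length (concatMap f xs) ≤ length xs * k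
  length-concatMap-≤ k []       _  = z≤n
  length-concatMap-≤ k (x ∷ xs) ≤k = begin
    length (f x ++ concatMap f xs)          ≡⟨ List.length-++ (f x) ⟩
    length (f x) + length (concatMap f xs)  ≤⟨ +-mono-≤ (≤k x (here refl)) (length-concatMap-≤ k xs (λ y y∈ → ≤k y (there y∈))) ⟩
    k + length xs * k                        ∎
    where open ≤-Reasoning

  length-concatMap-≡ : ∀ k xs → (∀ x → x ∈ xs → length (f x) ≡ k) → length (concatMap f xs) ≡ length xs * k
  length-concatMap-≡ k []       _  = refl
  length-concatMap-≡ k (x ∷ xs) ≡k =
    trans (List.length-++ (f x)) (cong₂ _+_ (≡k x (here refl)) (length-concatMap-≡ k xs (λ y y∈ → ≡k y (there y∈))))

  concatMap⁺ : ∀ {xs} → Unique xs → (∀ x → Unique (f x)) → (∀ {x y z} → z ∈ f x → z ∈ f y → x ≡ y) →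
               Unique (concatMap f xs)
  concatMap⁺ {[]}     _           _     _         = []
  concatMap⁺ {x ∷ xs} (x∉ ∷ xs!) fx! disjoint =
    Unique.++⁺ (fx! x) (concatMap⁺ xs! fx! disjoint) λ (z∈fx , z∈rest) →
      let y , y∈xs , z∈fy = ∈-concatMap⁻′ xs z∈rest
      in Unique.Unique[x∷xs]⇒x∉xs (x∉ ∷ xs!) (subst (_∈ xs) (sym (disjoint z∈fx z∈fy)) y∈xs)

splitAt-suffix : ∀ {A : Set} (xs : List A) k → k ≤ length xs → ∃ λ ys → ∃ λ zs → xs ≡ ys ++ zs × length zs ≡ k
splitAt-suffix xs k k≤ = take n xs , drop n xs , sym (List.take++drop≡id n xs) , trans (List.length-drop n xs) (m∸[m∸n]≡n k≤)
  where n = length xs ∸ k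

length-∷ʳ : ∀ {A : Set} (xs : List A) a → length (xs ∷ʳ a) ≡ suc (length xs)
length-∷ʳ xs a = trans (List.length-++ xs) (+-comm (length xs) 1)

toℕ-next : ∀ {m} (i : Fin (suc m)) →
            (toℕ i < m × toℕ (next i) ≡ suc (toℕ i)) ⊎ (toℕ i ≡ m × toℕ (next i) ≡ 0)
toℕ-next {m} i with m≤n⇒m<n∨m≡n (Fin.toℕ≤pred[n] i)
... | inj₁ i<m = inj₁ (i<m , (begin
  toℕ (next i)          ≡⟨ Fin.toℕ-fromℕ< _ ⟩
  (toℕ i + 1) % suc m   ≡⟨ m<n⇒m%n≡m (s≤s (subst (_≤ m) (+-comm 1 (toℕ i)) i<m)) ⟩
  toℕ i + 1             ≡⟨ +-comm (toℕ i) 1 ⟩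
  suc (toℕ i)           ∎))
  where open ≡-Reasoning
... | inj₂ i≡m = inj₂ (i≡m , (begin
  toℕ (next i)          ≡⟨ Fin.toℕ-fromℕ< _ ⟩
  (toℕ i + 1) % suc m   ≡⟨ cong (λ k → (k + 1) % suc m) i≡m ⟩
  (m + 1) % suc m       ≡⟨ cong (_% suc m) (+-comm m 1) ⟩
  suc m % suc m         ≡⟨ n%n≡0 (suc m) ⟩
  0                     ∎))
  where open ≡-Reasoning

[m%n+k]%n≡[m+k]%n : ∀ m k n .{{_ : NonZero n}} → (m % n + k) % n ≡ (m + k) % n
[m%n+k]%n≡[m+k]%n m k n = begin
  (m % n + k) % n          ≡⟨ %-distribˡ-+ (m % n) k n ⟩
  (m % n % n + k % n) % n  ≡⟨ cong (λ a → (a + k % n) % n) (m%n%n≡m%n m n) ⟩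
  (m % n + k % n) % n      ≡⟨ %-distribˡ-+ m k n ⟨
  (m + k) % n              ∎
  where open ≡-Reasoning

[m+k%n]%n≡[m+k]%n : ∀ m k n .{{_ : NonZero n}} → (m + k % n) % n ≡ (m + k) % n
[m+k%n]%n≡[m+k]%n m k n = begin
  (m + k % n) % n  ≡⟨ cong (_% n) (+-comm m (k % n)) ⟩
  (k % n + m) % n  ≡⟨ [m%n+k]%n≡[m+k]%n k m n ⟩
  (k + m) % n      ≡⟨ cong (_% n) (+-comm k m) ⟩
  (m + k) % n      ∎
  where open ≡-Reasoning

toℕ-mod : ∀ n m → toℕ (n mod suc m) ≡ n % suc m
toℕ-mod n m = Fin.toℕ-fromℕ< (m%n<n n (suc m))

mod-cong : ∀ {a b} m → a % suc m ≡ b % suc m → a mod suc m ≡ b mod suc m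
mod-cong {a} {b} m eq = Fin.toℕ-injective (trans (toℕ-mod a m) (trans eq (sym (toℕ-mod b m))))

next-mod : ∀ n m → next (n mod suc m) ≡ suc n mod suc m
next-mod n m = mod-cong {toℕ (n mod suc m) + 1} {suc n} m (begin
  (toℕ (n mod suc m) + 1) % suc m  ≡⟨ cong (λ k → (k + 1) % suc m) (toℕ-mod n m) ⟩
  (n % suc m + 1) % suc m          ≡⟨ [m%n+k]%n≡[m+k]%n n 1 (suc m) ⟩
  (n + 1) % suc m                  ≡⟨ cong (_% suc m) (+-comm n 1) ⟩
  suc n % suc m                    ∎)
  where open ≡-Reasoning

n≤1+⌊n/2⌋+⌊n/2⌋ : ∀ n → n ≤ suc (⌊ n /2⌋ + ⌊ n /2⌋)
n≤1+⌊n/2⌋+⌊n/2⌋ zero          = z≤n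
n≤1+⌊n/2⌋+⌊n/2⌋ (suc zero)    = s≤s z≤n
n≤1+⌊n/2⌋+⌊n/2⌋ (suc (suc n)) = s≤s (s≤s (≤-trans (n≤1+⌊n/2⌋+⌊n/2⌋ n) (≤-reflexive (sym (+-suc ⌊ n /2⌋ ⌊ n /2⌋)))))

n∸[1+⌊n/2⌋]≤⌊n/2⌋ : ∀ n → n ∸ suc ⌊ n /2⌋ ≤ ⌊ n /2⌋
n∸[1+⌊n/2⌋]≤⌊n/2⌋ n = begin
  n ∸ suc h                       ≤⟨ ∸-monoˡ-≤ (suc h) (n≤1+⌊n/2⌋+⌊n/2⌋ n) ⟩
  suc (h + h) ∸ suc h             ≡⟨ m+n∸m≡n h h ⟩
  h                               ∎
  where
  open ≤-Reasoning
  h = ⌊ n /2⌋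

geomSum-suc : ∀ x t → geomSum x (suc t) ≡ 1 + x * geomSum x t
geomSum-suc x zero    = cong suc (sym (*-zeroʳ x))
geomSum-suc x (suc t) = begin
  geomSum x (suc t) + x ^ suc t        ≡⟨ cong (_+ x ^ suc t) (geomSum-suc x t) ⟩
  1 + x * geomSum x t + x * x ^ t      ≡⟨ +-assoc 1 (x * geomSum x t) (x * x ^ t) ⟩
  1 + (x * geomSum x t + x * x ^ t)    ≡⟨ cong (1 +_) (*-distribˡ-+ x (geomSum x t) (x ^ t)) ⟨
  1 + x * (geomSum x t + x ^ t)        ∎
  where open ≡-Reasoning

isOdd-double : ∀ t → isOdd (t + t) ≡ false
isOdd-double zero    = refl
isOdd-double (suc t) = trans (cong (not ∘ isOdd) (+-suc t t)) (cong (not ∘ not) (isOdd-double t))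

mooreCount-odd : ∀ d t → mooreCount d (suc (t + t)) ≡ 1 + d * geomSum (d ∸ 1) t
mooreCount-odd d t rewrite isOdd-double t | sym (n≡⌈n+n/2⌉ t) = refl

mooreCount-even : ∀ d t → mooreCount d (suc (suc (t + t))) ≡ 2 * geomSum (d ∸ 1) (suc t)
mooreCount-even d t rewrite isOdd-double t | sym (n≡⌊n+n/2⌋ t) = refl

parity : ∀ m → (∃ λ t → m ≡ t + t) ⊎ (∃ λ t → m ≡ suc (t + t))
parity zero    = inj₁ (0 , refl)
parity (suc m) with parity m
... | inj₁ (t , m≡) = inj₂ (t , cong suc m≡)
... | inj₂ (t , m≡) = inj₁ (suc t , trans (cong suc m≡) (cong suc (sym (+-suc t t))))

module _ (G : Graph) where

  private
    V = Vertex G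
    O = OEdge G
    ι = init G
    τ = term G
    ρ = rev G

  _≟ₒ_ : DecidableEquality O
  _≟ₒ_ = Product.≡-dec Fin._≟_ Bool._≟_

  rev-involutive : ∀ o → ρ (ρ o) ≡ o
  rev-involutive (e , false) = refl
  rev-involutive (e , true)  = refl

  init-rev : ∀ o → ι (ρ o) ≡ τ o
  init-rev (e , false) = refl
  init-rev (e , true)  = refl

  term-rev : ∀ o → τ (ρ o) ≡ ι o
  term-rev (e , false) = refl
  term-rev (e , true)  = refl

  rev-≢ : ∀ o → o ≢ ρ o
  rev-≢ (e , false) ()
  rev-≢ (e , true)  ()

  rev-injective : ∀ {a b} → ρ a ≡ ρ b → a ≡ b
  rev-injective {a} {b} eq = trans (sym (rev-involutive a)) (trans (cong ρ eq) (rev-involutive b))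

  private
    orientations : Fin (nE G) → List O
    orientations e = (e , false) ∷ (e , true) ∷ []

  ∈-allOEdges : ∀ o → o ∈ allOEdges G
  ∈-allOEdges (e , false) = ∈-concatMap⁺′ orientations (∈-allFin e) (here refl)
  ∈-allOEdges (e , true)  = ∈-concatMap⁺′ orientations (∈-allFin e) (there (here refl))

  allOEdges-unique : Unique (allOEdges G)
  allOEdges-unique = concatMap⁺ orientations (Unique.allFin⁺ (nE G))
    (λ e → ((λ ()) ∷ []) ∷ [] ∷ []) same-edge
    where
    same-edge : ∀ {e e′ o} → o ∈ orientations e → o ∈ orientations e′ → e ≡ e′
    same-edge (here refl)         (here refl)         = refl
    same-edge (here refl)         (there (here ()))
    same-edge (there (here refl)) (here ())
    same-edge (there (here refl)) (there (here refl)) = refl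

  length-filter-rev : ∀ {P : Pred O 0ℓ} (P? : Decidable P) →
                      length (filter P? (allOEdges G)) ≡ length (filter (P? ∘ ρ) (allOEdges G))
  length-filter-rev P? = go (allFin (nE G))
    where
    go : ∀ es → length (filter P? (concatMap orientations es)) ≡ length (filter (P? ∘ ρ) (concatMap orientations es))
    go []       = refl
    go (e ∷ es) = begin
      length (filter P? (a ∷ b ∷ rest))                                 ≡⟨ length-filter-∷∷ P? ⟩
      indicator (P? a) + (indicator (P? b) + length (filter P? rest))   ≡⟨ cong (λ n → indicator (P? a) + (indicator (P? b) + n)) (go es) ⟩
      indicator (P? a) + (indicator (P? b) + length (filter (P? ∘ ρ) rest)) ≡⟨ +-left-comm (indicator (P? a)) (indicator (P? b)) _ ⟩
      indicator (P? b) + (indicator (P? a) + length (filter (P? ∘ ρ) rest)) ≡⟨ length-filter-∷∷ (P? ∘ ρ) ⟨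
      length (filter (P? ∘ ρ) (a ∷ b ∷ rest))                           ∎
      where
      open ≡-Reasoning
      a = (e , false)
      b = (e , true)
      rest = concatMap orientations es
      length-filter-∷∷ : ∀ {Q : Pred O 0ℓ} (Q? : Decidable Q) →
        length (filter Q? (a ∷ b ∷ rest)) ≡ indicator (Q? a) + (indicator (Q? b) + length (filter Q? rest))
      length-filter-∷∷ Q? = trans (length-filter-∷ Q? a _) (cong (indicator (Q? a) +_) (length-filter-∷ Q? b rest))

  ∑-deg : ∑ (nV G) (deg G) ≡ length (allOEdges G)
  ∑-deg = ∑-length-fibres (nV G) ι (allOEdges G)

  otherOut : O → List O
  otherOut o = filter (λ a → ι a Fin.≟ ι o ×-dec ¬? (a ≟ₒ o)) (allOEdges G)

  deg≡suc-otherOut : ∀ o → deg G (ι o) ≡ length (otherOut o) + 1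
  deg≡suc-otherOut o = trans (length-filter-remove _≟ₒ_ (λ a → ι a Fin.≟ ι o) o refl (allOEdges G))
    (cong (length (otherOut o) +_) (length-filter-≟-unique _≟ₒ_ (allOEdges G) allOEdges-unique (∈-allOEdges o)))

  -- Walks

  IsWalk : V → V → List O → Set
  IsWalk u v []       = u ≡ v
  IsWalk u v (o ∷ xs) = ι o ≡ u × IsWalk (τ o) v xs

  Reduced : List O → Set
  Reduced (a ∷ b ∷ xs) = b ≢ ρ a × Reduced (b ∷ xs)
  Reduced _            = ⊤

  Continues : List O → O → Set
  Continues xs y = maybe′ (λ a → y ≢ ρ a) ⊤ (last xs)

  Reduced-tail : ∀ {x} xs → Reduced (x ∷ xs) → Reduced xs
  Reduced-tail []      _       = tt
  Reduced-tail (_ ∷ _) (_ , r) = r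

  Reduced-++ : ∀ xs {y} ys → Reduced xs → Reduced (y ∷ ys) → Continues xs y → Reduced (xs ++ y ∷ ys)
  Reduced-++ []            ys _       r′ _ = r′
  Reduced-++ (x ∷ [])      ys _       r′ c = c , r′
  Reduced-++ (x ∷ x′ ∷ xs) ys (t , r) r′ c = t , Reduced-++ (x′ ∷ xs) ys r r′ c

  Reduced-++⁻ˡ : ∀ xs ys → Reduced (xs ++ ys) → Reduced xs
  Reduced-++⁻ˡ []            ys _       = tt
  Reduced-++⁻ˡ (x ∷ [])      ys _       = tt
  Reduced-++⁻ˡ (x ∷ x′ ∷ xs) ys (t , r) = t , Reduced-++⁻ˡ (x′ ∷ xs) ys r

  Reduced-++⁻ʳ : ∀ xs ys → Reduced (xs ++ ys) → Reduced ys
  Reduced-++⁻ʳ []            ys r       = r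
  Reduced-++⁻ʳ (x ∷ xs)      ys r       = Reduced-++⁻ʳ xs ys (Reduced-tail (xs ++ ys) r)

  Reduced-++-backtrack : ∀ xs a y ys → Reduced (xs ++ a ∷ y ∷ ys) → y ≢ ρ a
  Reduced-++-backtrack []       a y ys (t , _) = t
  Reduced-++-backtrack (x ∷ xs) a y ys r       = Reduced-++-backtrack xs a y ys (Reduced-tail (xs ++ a ∷ y ∷ ys) r)

  last-∷ʳ : ∀ (xs : List O) a → last (xs ∷ʳ a) ≡ just a
  last-∷ʳ []            a = refl
  last-∷ʳ (x ∷ [])      a = refl
  last-∷ʳ (x ∷ x′ ∷ xs) a = last-∷ʳ (x′ ∷ xs) a

  Continues-∷ʳ : ∀ xs a {y} → y ≢ ρ a → Continues (xs ∷ʳ a) y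
  Continues-∷ʳ xs a y≢ rewrite last-∷ʳ xs a = y≢

  IsWalk-++ : ∀ {u v w} xs {ys} → IsWalk u v xs → IsWalk v w ys → IsWalk u w (xs ++ ys)
  IsWalk-++ []       refl      q = q
  IsWalk-++ (o ∷ xs) (o↦u , p) q = o↦u , IsWalk-++ xs p q

  IsWalk-++⁻ : ∀ {u v} xs {ys} → IsWalk u v (xs ++ ys) → ∃ λ w → IsWalk u w xs × IsWalk w v ys
  IsWalk-++⁻ []       p         = _ , refl , p
  IsWalk-++⁻ (o ∷ xs) (o↦u , p) = let w , p₁ , p₂ = IsWalk-++⁻ xs p in w , (o↦u , p₁) , p₂

  IsWalk-target : ∀ {u v w} xs → IsWalk u v xs → IsWalk u w xs → v ≡ w
  IsWalk-target []       p       q       = trans (sym p) q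
  IsWalk-target (o ∷ xs) (_ , p) (_ , q) = IsWalk-target xs p q

  reverseWalk : List O → List O
  reverseWalk []       = []
  reverseWalk (o ∷ xs) = reverseWalk xs ∷ʳ ρ o

  length-reverseWalk : ∀ xs → length (reverseWalk xs) ≡ length xs
  length-reverseWalk []       = refl
  length-reverseWalk (o ∷ xs) = trans (length-∷ʳ (reverseWalk xs) (ρ o)) (cong suc (length-reverseWalk xs))

  IsWalk-reverse : ∀ {u v} xs → IsWalk u v xs → IsWalk v u (reverseWalk xs)
  IsWalk-reverse []       refl      = refl
  IsWalk-reverse (o ∷ xs) (o↦u , p) = IsWalk-++ (reverseWalk xs) (IsWalk-reverse xs p) (init-rev o , trans (term-rev o) o↦u)

  Reduced-reverse : ∀ xs → Reduced xs → Reduced (reverseWalk xs)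
  Reduced-reverse []            _       = tt
  Reduced-reverse (x ∷ [])      _       = tt
  Reduced-reverse (x ∷ y ∷ xs)  (t , r) =
    Reduced-++ (reverseWalk (y ∷ xs)) [] (Reduced-reverse (y ∷ xs) r) tt
      (Continues-∷ʳ (reverseWalk xs) (ρ y) (λ eq → t (trans (sym (rev-involutive y)) (cong ρ (sym (rev-injective eq))))))

  reduce : ∀ {u v} xs → IsWalk u v xs → ∃ λ ys → IsWalk u v ys × Reduced ys × length ys ≤ length xs
  reduce []       p         = [] , p , tt , z≤n
  reduce (o ∷ xs) (o↦u , p) with reduce xs p
  ... | []     , q         , _ , _  = [ o ] , (o↦u , q) , tt , s≤s z≤n
  ... | y ∷ ys , (y↦ , q) , r , ≤xs with y ≟ₒ ρ o
  ...   | yes refl = ys , subst (λ z → IsWalk z _ ys) (trans (term-rev o) o↦u) q , Reduced-tail ys r , m≤n⇒m≤1+n (≤-trans (n≤1+n _) ≤xs)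
  ...   | no y≢    = o ∷ y ∷ ys , (o↦u , y↦ , q) , (y≢ , r) , s≤s ≤xs

  Walk⇒IsWalk : ∀ {u v} → Walk G u v → ∃ (IsWalk u v)
  Walk⇒IsWalk nil        = [] , refl
  Walk⇒IsWalk (cons o w) = let xs , p = Walk⇒IsWalk w in o ∷ xs , refl , p

  connected⇒reducedWalk : Connected G → ∀ u v → ∃ λ xs → IsWalk u v xs × Reduced xs
  connected⇒reducedWalk conn u v =
    let xs , p = Walk⇒IsWalk (conn u v) ; ys , q , r , _ = reduce xs p in ys , q , r

  _↝_ : O → O → Set
  a ↝ b = τ a ≡ ι b × b ≢ ρ a

  ReducedUpTo : (ℕ → O) → ℕ → Set
  ReducedUpTo f L = ∀ n → suc n < L → f n ↝ f (suc n)

  toClosedGeodesic : ∀ m f → ReducedUpTo f (suc m) → τ (f m) ≡ ι (f 0) → f 0 ≢ ρ (f m) →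
                     IsClosedGeodesic G (suc m) (f ∘ toℕ)
  toClosedGeodesic m f r closed no-backtrack = proj₁ ∘ step , proj₂ ∘ step
    where
    step : ∀ i → f (toℕ i) ↝ f (toℕ (next i))
    step i with toℕ-next i
    ... | inj₁ (i<m , eq) rewrite eq        = r (toℕ i) (s≤s i<m)
    ... | inj₂ (i≡m , eq) rewrite eq | i≡m = closed , no-backtrack

  lookupOr : O → List O → ℕ → O
  lookupOr d []       n       = d
  lookupOr d (x ∷ xs) zero    = x
  lookupOr d (x ∷ xs) (suc n) = lookupOr d xs n

  ReducedUpTo-lookupOr : ∀ {u v} d xs → IsWalk u v xs → Reduced xs → ReducedUpTo (lookupOr d xs) (length xs)
  ReducedUpTo-lookupOr d (x ∷ y ∷ xs) (_ , y↦ , _) (t , _) zero    _         = sym y↦ , t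
  ReducedUpTo-lookupOr d (x ∷ xs)     (_ , p)      r       (suc n) (s≤s n<) =
    ReducedUpTo-lookupOr d xs p (Reduced-tail xs r) n n<

  term-lookupOr-last : ∀ {u v} d x xs → IsWalk u v (x ∷ xs) → τ (lookupOr d (x ∷ xs) (length xs)) ≡ v
  term-lookupOr-last d x []       (_ , p) = p
  term-lookupOr-last d x (y ∷ xs) (_ , p) = term-lookupOr-last d y xs p

  IsGirth-unique : ∀ {g g′} → IsGirth G g → IsGirth G g′ → g ≡ g′
  IsGirth-unique (1≤g , (w , cg) , minimal) (1≤g′ , (w′ , cg′) , minimal′) =
    ≤-antisym (minimal _ w′ 1≤g′ cg′) (minimal′ _ w 1≤g cg)

  -- Girth

  module Girth {g} (gir : IsGirth G g) where

    girth≤closedGeodesic : ∀ L (w : Fin L → O) → 1 ≤ L → IsClosedGeodesic G L w → g ≤ L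
    girth≤closedGeodesic = proj₂ (proj₂ gir)

    girth≤closed : ∀ m f → ReducedUpTo f (suc m) → τ (f m) ≡ ι (f 0) → g ≤ suc m
    girth+2≤backtracking : ∀ m f → ReducedUpTo f (suc m) → τ (f m) ≡ ι (f 0) → f 0 ≡ ρ (f m) → g + 2 ≤ suc m

    girth≤closed m f r closed with f 0 ≟ₒ ρ (f m)
    ... | no  nb = girth≤closedGeodesic (suc m) _ (s≤s z≤n) (toClosedGeodesic m f r closed nb)
    ... | yes bt = ≤-trans (m≤m+n g 2) (girth+2≤backtracking m f r closed bt)

    -- A closed walk that backtracks through its start point shortens by its first and last edges.
    girth+2≤backtracking zero          f r closed bt = contradiction bt (rev-≢ (f 0))
    girth+2≤backtracking (suc zero)    f r closed bt =
      contradiction (trans (sym (rev-involutive (f 1))) (cong ρ (sym bt))) (proj₂ (r 0 (s≤s (s≤s z≤n))))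
    girth+2≤backtracking (suc (suc m)) f r closed bt =
      subst (_≤ suc (suc (suc m))) (+-comm 2 g) (s≤s (s≤s (girth≤closed m (f ∘ suc) (λ n n< → r (suc n) (m≤n⇒m≤1+n (s≤s n<))) closed′)))
      where
      closed′ : τ (f (suc m)) ≡ ι (f 1)
      closed′ = begin
        τ (f (suc m))        ≡⟨ proj₁ (r (suc m) ≤-refl) ⟩
        ι (f (suc (suc m)))  ≡⟨ cong ι (trans (sym (rev-involutive _)) (cong ρ (sym bt))) ⟩
        ι (ρ (f 0))          ≡⟨ init-rev (f 0) ⟩
        τ (f 0)              ≡⟨ proj₁ (r 0 (s≤s (s≤s z≤n))) ⟩
        ι (f 1)              ∎
        where open ≡-Reasoning

    girth≤length : ∀ {u} xs → IsWalk u u xs → Reduced xs → 1 ≤ length xs → g ≤ length xs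
    girth≤length (x ∷ xs) p r _ = girth≤closed (length xs) (lookupOr x (x ∷ xs)) (ReducedUpTo-lookupOr x (x ∷ xs) p r)
      (trans (term-lookupOr-last x x xs p) (sym (proj₁ p)))

    reduced-walks-unique : ∀ {u v} P Q → IsWalk u v P → Reduced P → IsWalk u v Q → Reduced Q →
                           length P + length Q < g → P ≡ Q
    reduced-walks-unique []      []      _    _  _    _  _     = refl
    reduced-walks-unique []      (q ∷ Q) refl _  pQ   rQ short = contradiction (girth≤length (q ∷ Q) pQ rQ (s≤s z≤n)) (<⇒≱ short)
    reduced-walks-unique (p ∷ P) []      pP   rP refl _  short =
      contradiction (girth≤length (p ∷ P) pP rP (s≤s z≤n)) (<⇒≱ (subst (_< g) (+-identityʳ _) short))
    reduced-walks-unique {v = v} (p ∷ P) (q ∷ Q) pP rP pQ rQ short with p ≟ₒ q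
    ... | yes refl = cong (p ∷_) (reduced-walks-unique P Q (proj₂ pP) (Reduced-tail P rP) (proj₂ pQ) (Reduced-tail Q rQ)
                                    (≤-trans (s≤s (+-monoʳ-≤ (length P) (n≤1+n (length Q)))) (<⇒≤ short)))
    ... | no p≢q   = contradiction (girth≤length R pR rR (subst (1 ≤_) (sym length-R) (s≤s z≤n)))
                                   (<⇒≱ (subst (_< g) (sym length-R) short))
      where
      R = reverseWalk (q ∷ Q) ++ p ∷ P
      pR : IsWalk v v R
      pR = IsWalk-++ (reverseWalk (q ∷ Q)) (IsWalk-reverse (q ∷ Q) pQ) pP
      rR : Reduced R
      rR = Reduced-++ (reverseWalk (q ∷ Q)) P (Reduced-reverse (q ∷ Q) rQ) rP
             (Continues-∷ʳ (reverseWalk Q) (ρ q) (λ p≡ρρq → p≢q (trans p≡ρρq (rev-involutive q))))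
      length-R : length R ≡ suc (length P) + suc (length Q)
      length-R = begin
        length R                                          ≡⟨ List.length-++ (reverseWalk (q ∷ Q)) ⟩
        length (reverseWalk (q ∷ Q)) + suc (length P)    ≡⟨ cong (_+ suc (length P)) (length-reverseWalk (q ∷ Q)) ⟩
        suc (length Q) + suc (length P)                  ≡⟨ +-comm (suc (length Q)) _ ⟩
        suc (length P) + suc (length Q)                  ∎
        where open ≡-Reasoning

    -- Closing a reduced walk by a short reduced return walk cannot backtrack at the junction:
    -- otherwise the return walk and the reversed walk would be two distinct short reduced walks.
    Reduced-++-short : ∀ {u y} ws a q → IsWalk u y (ws ∷ʳ a) → Reduced (ws ∷ʳ a) → IsWalk y u q → Reduced q →
                       length q ≤ length ws → length q + length ws ≤ g → Reduced ((ws ∷ʳ a) ++ q)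
    Reduced-++-short ws a []      _  rW _         _  _   _  = subst Reduced (sym (List.++-identityʳ (ws ∷ʳ a))) rW
    Reduced-++-short ws a (b ∷ q) pW rW (b↦ , pq) rq q≤ws ≤g with b ≟ₒ ρ a
    ... | no  b≢  = Reduced-++ (ws ∷ʳ a) q rW rq (Continues-∷ʳ ws a b≢)
    ... | yes refl = contradiction (subst (λ k → suc k ≤ length ws) (trans (cong length q≡) (length-reverseWalk ws)) q≤ws)
                                   (<-irrefl refl)
      where
      split = IsWalk-++⁻ ws pW
      pws : IsWalk _ (ι a) ws
      pws = subst (λ w → IsWalk _ w ws) (sym (proj₁ (proj₂ (proj₂ split)))) (proj₁ (proj₂ split))
      q≡ : q ≡ reverseWalk ws
      q≡ = reduced-walks-unique q (reverseWalk ws) (subst (λ w → IsWalk w _ q) (term-rev a) pq) (Reduced-tail q rq)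
             (IsWalk-reverse ws pws) (Reduced-reverse ws (Reduced-++⁻ˡ ws [ a ] rW))
             (subst (λ k → length q + k < g) (sym (length-reverseWalk ws)) ≤g)

    short-closed⇒closedGeodesic : ∀ {u} x xs → IsWalk u u (x ∷ xs) → Reduced (x ∷ xs) → suc (length xs) ≤ g →
      suc (length xs) ≡ g × IsClosedGeodesic G (suc (length xs)) (lookupOr x (x ∷ xs) ∘ toℕ)
    short-closed⇒closedGeodesic x xs p r ≤g = decide (x ≟ₒ ρ (F (length xs)))
      where
      F = lookupOr x (x ∷ xs)
      reduced = ReducedUpTo-lookupOr x (x ∷ xs) p r
      closed = trans (term-lookupOr-last x x xs p) (sym (proj₁ p))
      decide : Dec (F 0 ≡ ρ (F (length xs))) →
               suc (length xs) ≡ g × IsClosedGeodesic G (suc (length xs)) (F ∘ toℕ)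
      decide (yes bt) = contradiction (≤-trans (girth+2≤backtracking (length xs) F reduced closed bt) ≤g) (m+1+n≰m g)
      decide (no nb)  = ≤-antisym ≤g (girth≤closed (length xs) F reduced closed) , toClosedGeodesic (length xs) F reduced closed nb

    girth≤closing : ∀ {u v} ws a z → IsWalk u v (ws ∷ʳ a) → Reduced (ws ∷ʳ a) → IsWalk v u z → Reduced z →
                    length z ≤ length ws → length z + length ws ≤ g → g ≤ length ((ws ∷ʳ a) ++ z)
    girth≤closing ws a z p r pz rz z≤ws ≤g =
      girth≤length ((ws ∷ʳ a) ++ z) (IsWalk-++ (ws ∷ʳ a) p pz) (Reduced-++-short ws a z p r pz rz z≤ws ≤g)
        (≤-trans (subst (1 ≤_) (sym (length-∷ʳ ws a)) (s≤s z≤n)) (List.length-++-≤ˡ (ws ∷ʳ a)))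

  -- Sequences of oriented edges and shortest cycles

  ReducedSeq : (ℕ → O) → Set
  ReducedSeq F = ∀ n → F n ↝ F (suc n)

  window : (ℕ → O) → ℕ → ℕ → List O
  window F a zero      = []
  window F a (suc len) = F a ∷ window F (suc a) len

  length-window : ∀ F a len → length (window F a len) ≡ len
  length-window F a zero      = refl
  length-window F a (suc len) = cong suc (length-window F (suc a) len)

  IsWalk-window : ∀ F a len → ReducedSeq F → IsWalk (ι (F a)) (ι (F (a + len))) (window F a len)
  IsWalk-window F a zero      r = cong (ι ∘ F) (sym (+-identityʳ a))
  IsWalk-window F a (suc len) r = refl ,
    subst₂ (λ u v → IsWalk u v (window F (suc a) len)) (sym (proj₁ (r a))) (cong (ι ∘ F) (sym (+-suc a len)))
      (IsWalk-window F (suc a) len r)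

  Reduced-window : ∀ F a len → ReducedSeq F → Reduced (window F a len)
  Reduced-window F a zero            r = tt
  Reduced-window F a (suc zero)      r = tt
  Reduced-window F a (suc (suc len)) r = proj₂ (r a) , Reduced-window F (suc a) (suc len) r

  window-injective : ∀ F H a len → window F a len ≡ window H a len → ∀ i → i < len → F (a + i) ≡ H (a + i)
  window-injective F H a (suc len) eq zero    _        =
    trans (cong F (+-identityʳ a)) (trans (List.∷-injectiveˡ eq) (cong H (sym (+-identityʳ a))))
  window-injective F H a (suc len) eq (suc i) (s≤s i<) =
    trans (cong F (+-suc a i)) (trans (window-injective F H (suc a) len (List.∷-injectiveʳ eq) i i<) (cong H (sym (+-suc a i))))

  window-cong : ∀ F H a len → (∀ i → i < len → F (a + i) ≡ H (a + i)) → window F a len ≡ window H a len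
  window-cong F H a zero      _     = refl
  window-cong F H a (suc len) agree = cong₂ _∷_
    (trans (cong F (sym (+-identityʳ a))) (trans (agree 0 (s≤s z≤n)) (cong H (+-identityʳ a))))
    (window-cong F H (suc a) len (λ i i< → trans (cong F (sym (+-suc a i))) (trans (agree (suc i) (s≤s i<)) (cong H (+-suc a i)))))

  window-suc : ∀ F a len → window F (suc a) len ≡ window (F ∘ suc) a len
  window-suc F a zero      = refl
  window-suc F a (suc len) = cong (F (suc a) ∷_) (window-suc F (suc a) len)

  window-lookupOr : ∀ d xs zs → window (lookupOr d (xs ++ zs)) 0 (length xs) ≡ xs
  window-lookupOr d []       zs = refl
  window-lookupOr d (x ∷ xs) zs = cong (x ∷_) (trans (window-suc (lookupOr d (x ∷ xs ++ zs)) 0 (length xs)) (window-lookupOr d xs zs))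

  module Cyclic (m : ℕ) where

    cyclic : (Fin (suc m) → O) → ℕ → O
    cyclic c n = c (n mod suc m)

    cyclic-toℕ : ∀ c i → cyclic c (toℕ i) ≡ c i
    cyclic-toℕ c i = cong c (Fin.toℕ-injective (trans (toℕ-mod (toℕ i) m) (m<n⇒m%n≡m (Fin.toℕ<n i))))

    cyclic-cong : ∀ c a b → a % suc m ≡ b % suc m → cyclic c a ≡ cyclic c b
    cyclic-cong c a b eq = cong c (mod-cong {a} {b} m eq)

    cyclic-periodic : ∀ c n → cyclic c (n + suc m) ≡ cyclic c n
    cyclic-periodic c n = cyclic-cong c (n + suc m) n ([m+n]%n≡m%n n (suc m))

    ReducedSeq-cyclic : ∀ c → IsClosedGeodesic G (suc m) c → ReducedSeq (cyclic c)
    ReducedSeq-cyclic c (closed , geodesic) n =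
      subst (λ i → τ (cyclic c n) ≡ ι (c i)) (next-mod n m) (closed (n mod suc m)) ,
      subst (λ i → c i ≢ ρ (cyclic c n)) (next-mod n m) (geodesic (n mod suc m))

  module GirthCycles (m : ℕ) (gir : IsGirth G (suc m)) where
    open Girth gir public
    open Cyclic m public

    h : ℕ
    h = ⌊ suc m /2⌋

    h<girth : h < suc m
    h<girth = ⌊n/2⌋<n m

    baseEdge : O
    baseEdge = proj₁ (proj₁ (proj₂ gir)) fz

    basepoint : V
    basepoint = ι baseEdge

    -- The windows of C and D after position h are reduced walks with common endpoints whose
    -- total length is less than the girth, so they coincide.
    agree-on-half⇒agree : ∀ C D → ReducedSeq C → ReducedSeq D → C (suc m) ≡ C 0 → D (suc m) ≡ D 0 →
                          (∀ n → n ≤ h → C n ≡ D n) → ∀ n → n < suc m → C n ≡ D n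
    agree-on-half⇒agree C D rC rD periodicC periodicD agree n n<g with n ≤? h
    ... | yes n≤h = agree n n≤h
    ... | no  n≰h = subst (λ k → C k ≡ D k) (m+[n∸m]≡n h<n)
                      (window-injective C D (suc h) x windows-equal (n ∸ suc h) (∸-monoˡ-< n<g h<n))
      where
      h<n = ≰⇒> n≰h
      x = suc m ∸ suc h
      h+x≡g : suc h + x ≡ suc m
      h+x≡g = m+[n∸m]≡n h<girth
      start : ι (D (suc h)) ≡ ι (C (suc h))
      start = trans (sym (proj₁ (rD h))) (trans (cong τ (sym (agree h ≤-refl))) (proj₁ (rC h)))
      end : ∀ F → F (suc m) ≡ F 0 → ι (F (suc h + x)) ≡ ι (F 0)
      end F periodic = trans (cong (ι ∘ F) h+x≡g) (cong ι periodic)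
      short : length (window C (suc h) x) + length (window D (suc h) x) < suc m
      short = subst₂ (λ a b → a + b < suc m) (sym (length-window C (suc h) x)) (sym (length-window D (suc h) x))
        (begin-strict
          x + x      ≤⟨ +-monoʳ-≤ x (n∸[1+⌊n/2⌋]≤⌊n/2⌋ (suc m)) ⟩
          x + h      <⟨ +-monoʳ-< x (n<1+n h) ⟩
          x + suc h  ≡⟨ trans (+-comm x (suc h)) h+x≡g ⟩
          suc m      ∎)
        where open ≤-Reasoning
      windows-equal : window C (suc h) x ≡ window D (suc h) x
      windows-equal = reduced-walks-unique (window C (suc h) x) (window D (suc h) x)
        (subst (λ v → IsWalk (ι (C (suc h))) v (window C (suc h) x)) (end C periodicC) (IsWalk-window C (suc h) x rC)) (Reduced-window C (suc h) x rC)
        (subst₂ (λ u v → IsWalk u v (window D (suc h) x)) start (trans (end D periodicD) (cong ι (sym (agree 0 z≤n)))) (IsWalk-window D (suc h) x rD))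
        (Reduced-window D (suc h) x rD) short

    closedGeodesic⇒cycle : ∀ w → IsClosedGeodesic G (suc m) w → IsCycle G (suc m) w
    closedGeodesic⇒cycle w cg = proj₁ cg , injective
      where
      no-repeat : ∀ i j → toℕ i < toℕ j → ι (w i) ≢ ι (w j)
      no-repeat i j i<j eq = contradiction (≤-trans (girth≤closed k f reduced closed) k<m) (<-irrefl refl)
        where
        k = toℕ j ∸ suc (toℕ i)
        i+k : suc (toℕ i + k) ≡ toℕ j
        i+k = m+[n∸m]≡n i<j
        k<m : k < m
        k<m = ≤-trans (s≤s (m≤n+m k (toℕ i))) (≤-trans (≤-reflexive i+k) (Fin.toℕ≤pred[n] j))
        f : ℕ → O
        f n = cyclic w (toℕ i + n)
        reduced : ReducedUpTo f (suc k)
        reduced n _ = subst (λ a → f n ↝ cyclic w a) (sym (+-suc (toℕ i) n)) (ReducedSeq-cyclic w cg (toℕ i + n))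
        closed : τ (f k) ≡ ι (f 0)
        closed = begin
          τ (f k)                        ≡⟨ proj₁ (ReducedSeq-cyclic w cg (toℕ i + k)) ⟩
          ι (cyclic w (suc (toℕ i + k))) ≡⟨ cong (ι ∘ cyclic w) i+k ⟩
          ι (cyclic w (toℕ j))           ≡⟨ cong ι (cyclic-toℕ w j) ⟩
          ι (w j)                        ≡⟨ eq ⟨
          ι (w i)                        ≡⟨ cong ι (cyclic-toℕ w i) ⟨
          ι (cyclic w (toℕ i))           ≡⟨ cong (ι ∘ cyclic w) (+-identityʳ (toℕ i)) ⟨
          ι (f 0)                        ∎
          where open ≡-Reasoning
      injective : ∀ {i j} → ι (w i) ≡ ι (w j) → i ≡ j
      injective {i} {j} eq with <-cmp (toℕ i) (toℕ j)
      ... | tri< i<j _ _ = contradiction eq (no-repeat i j i<j)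
      ... | tri≈ _ i≡j _ = Fin.toℕ-injective i≡j
      ... | tri> _ _ j<i = contradiction (sym eq) (no-repeat j i j<i)

  -- Enumerating reduced walks

  _↝?_ : ∀ a b → Dec (a ↝ b)
  a ↝? b = (τ a Fin.≟ ι b) ×-dec ¬? (b ≟ₒ ρ a)

  extendBack : List O → List (List O)
  extendBack []       = []
  extendBack (y ∷ ys) = map (_∷ y ∷ ys) (filter (_↝? y) (allOEdges G))

  length-extendBack : ∀ y ys → length (extendBack (y ∷ ys)) ≡ deg G (ι y) ∸ 1
  length-extendBack y ys = begin
    length (extendBack (y ∷ ys))                      ≡⟨ List.length-map _ (filter (_↝? y) (allOEdges G)) ⟩
    length (filter (_↝? y) (allOEdges G))             ≡⟨ length-filter-rev (_↝? y) ⟩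
    length (filter ((_↝? y) ∘ ρ) (allOEdges G))       ≡⟨ length-filter-cong _ _ rev↝⇒other other⇒rev↝ (allOEdges G) ⟩
    length (otherOut y)                               ≡⟨ m+n∸n≡m _ 1 ⟨
    length (otherOut y) + 1 ∸ 1                       ≡⟨ cong (_∸ 1) (deg≡suc-otherOut y) ⟨
    deg G (ι y) ∸ 1                                   ∎
    where
    open ≡-Reasoning
    rev↝⇒other : ∀ o → ρ o ↝ y → ι o ≡ ι y × o ≢ y
    rev↝⇒other o (ρo↦ , y≢) = trans (sym (term-rev o)) ρo↦ , λ o≡y → y≢ (trans (sym o≡y) (sym (rev-involutive o)))
    other⇒rev↝ : ∀ o → ι o ≡ ι y × o ≢ y → ρ o ↝ y
    other⇒rev↝ o (o↦ , o≢y) = trans (term-rev o) o↦ , λ y≡ → o≢y (sym (trans y≡ (rev-involutive o)))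

  ∈-extendBack⁻ : ∀ {z} xs → z ∈ extendBack xs → ∃ λ o → ∃ λ y → ∃ λ ys → xs ≡ y ∷ ys × z ≡ o ∷ y ∷ ys × o ↝ y
  ∈-extendBack⁻ (y ∷ ys) z∈ with ∈-map⁻ (_∷ y ∷ ys) z∈
  ... | o , o∈ , refl = o , y , ys , refl , refl , proj₂ (∈-filter⁻ (_↝? y) {xs = allOEdges G} o∈)

  ∈-extendBack⁺ : ∀ {o y} ys → o ↝ y → (o ∷ y ∷ ys) ∈ extendBack (y ∷ ys)
  ∈-extendBack⁺ {o} {y} ys o↝y = ∈-map⁺ (_∷ y ∷ ys) (∈-filter⁺ (_↝? y) (∈-allOEdges o) o↝y)

  extendBack-unique : ∀ xs → Unique (extendBack xs)
  extendBack-unique []       = []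
  extendBack-unique (y ∷ ys) = Unique.map⁺ List.∷-injectiveˡ (Unique.filter⁺ (_↝? y) allOEdges-unique)

  extend : ℕ → List (List O) → List (List O)
  extend zero    s = s
  extend (suc l) s = concatMap extendBack (extend l s)

  ∈-extend⁺ : ∀ l s {o y} ys → (y ∷ ys) ∈ extend l s → o ↝ y → (o ∷ y ∷ ys) ∈ extend (suc l) s
  ∈-extend⁺ l s ys y∈ o↝y = ∈-concatMap⁺′ extendBack y∈ (∈-extendBack⁺ ys o↝y)

  ∈-extend-suc⁻ : ∀ l s {z} → z ∈ extend (suc l) s →
                  ∃ λ o → ∃ λ y → ∃ λ ys → z ≡ o ∷ y ∷ ys × (y ∷ ys) ∈ extend l s × o ↝ y
  ∈-extend-suc⁻ l s z∈ with ∈-concatMap⁻′ extendBack (extend l s) z∈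
  ... | xs , xs∈ , z∈′ with ∈-extendBack⁻ xs z∈′
  ... | o , y , ys , refl , refl , o↝y = o , y , ys , refl , xs∈ , o↝y

  extend-induction : ∀ (P : List O → Set) → (∀ {o y} ys → o ↝ y → P (y ∷ ys) → P (o ∷ y ∷ ys)) →
                     ∀ s → (∀ z → z ∈ s → P z) → ∀ l z → z ∈ extend l s → P z
  extend-induction P step s base zero    z z∈ = base z z∈
  extend-induction P step s base (suc l) z z∈ with ∈-extend-suc⁻ l s z∈
  ... | o , y , ys , refl , y∈ , o↝y = step ys o↝y (extend-induction P step s base l (y ∷ ys) y∈)

  extend-unique : ∀ l s → Unique s → Unique (extend l s)
  extend-unique zero    s s! = s!
  extend-unique (suc l) s s! = concatMap⁺ extendBack (extend-unique l s s!) extendBack-unique same-source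
    where
    same-source : ∀ {x y z} → z ∈ extendBack x → z ∈ extendBack y → x ≡ y
    same-source {x} {y} z∈x z∈y with ∈-extendBack⁻ x z∈x | ∈-extendBack⁻ y z∈y
    ... | _ , _ , _ , refl , refl , _ | _ , _ , _ , refl , refl , _ = refl

  length-extend-≤ : ∀ d → (∀ v → deg G v ≤ d) → ∀ l s → length (extend l s) ≤ length s * (d ∸ 1) ^ l
  length-extend-≤ d deg≤ zero    s = ≤-reflexive (sym (*-identityʳ _))
  length-extend-≤ d deg≤ (suc l) s = begin
    length (concatMap extendBack (extend l s)) ≤⟨ length-concatMap-≤ extendBack (d ∸ 1) (extend l s) (λ xs _ → extendBack≤ xs) ⟩
    length (extend l s) * (d ∸ 1)              ≤⟨ *-monoˡ-≤ (d ∸ 1) (length-extend-≤ d deg≤ l s) ⟩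
    length s * (d ∸ 1) ^ l * (d ∸ 1)           ≡⟨ *-assoc (length s) _ _ ⟩
    length s * ((d ∸ 1) ^ l * (d ∸ 1))         ≡⟨ cong (length s *_) (*-comm ((d ∸ 1) ^ l) (d ∸ 1)) ⟩
    length s * (d ∸ 1) ^ suc l                 ∎
    where
    open ≤-Reasoning
    extendBack≤ : ∀ xs → length (extendBack xs) ≤ d ∸ 1
    extendBack≤ []       = z≤n
    extendBack≤ (y ∷ ys) = subst (_≤ d ∸ 1) (sym (length-extendBack y ys)) (∸-monoˡ-≤ 1 (deg≤ (ι y)))

  length-∈-extend : ∀ l os z → z ∈ extend l (map [_] os) → length z ≡ suc l
  length-∈-extend zero    os z z∈ with ∈-map⁻ [_] z∈
  ... | _ , _ , refl = refl
  length-∈-extend (suc l) os z z∈ with ∈-extend-suc⁻ l (map [_] os) z∈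
  ... | _ , y , ys , refl , y∈ , _ = cong suc (length-∈-extend l os (y ∷ ys) y∈)

  length-extend-≡ : ∀ d → IsRegular G d → ∀ l os → length (extend l (map [_] os)) ≡ length os * (d ∸ 1) ^ l
  length-extend-≡ d regular zero    os = trans (List.length-map [_] os) (sym (*-identityʳ _))
  length-extend-≡ d regular (suc l) os = begin
    length (concatMap extendBack (extend l s)) ≡⟨ length-concatMap-≡ extendBack (d ∸ 1) (extend l s) extendBack≡ ⟩
    length (extend l s) * (d ∸ 1)              ≡⟨ cong (_* (d ∸ 1)) (length-extend-≡ d regular l os) ⟩
    length os * (d ∸ 1) ^ l * (d ∸ 1)          ≡⟨ *-assoc (length os) _ _ ⟩
    length os * ((d ∸ 1) ^ l * (d ∸ 1))        ≡⟨ cong (length os *_) (*-comm ((d ∸ 1) ^ l) (d ∸ 1)) ⟩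
    length os * (d ∸ 1) ^ suc l                ∎
    where
    open ≡-Reasoning
    s = map [_] os
    extendBack≡ : ∀ xs → xs ∈ extend l s → length (extendBack xs) ≡ d ∸ 1
    extendBack≡ []       []∈ = case length-∈-extend l os [] []∈ of λ ()
    extendBack≡ (y ∷ ys) _   = trans (length-extendBack y ys) (cong (_∸ 1) (regular (ι y)))

  singletons : List (List O)
  singletons = map [_] (allOEdges G)

  reducedWalks : ℕ → List (List O)
  reducedWalks l = extend l singletons

  ∈-reducedWalks⁺ : ∀ l {u v} xs → length xs ≡ suc l → IsWalk u v xs → Reduced xs → xs ∈ reducedWalks l
  ∈-reducedWalks⁺ zero    (o ∷ [])     refl _             _        = ∈-map⁺ [_] (∈-allOEdges o)
  ∈-reducedWalks⁺ (suc l) (o ∷ y ∷ ys) len  (_ , y↦ , p) (y≢ , r) =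
    ∈-extend⁺ l singletons ys (∈-reducedWalks⁺ l (y ∷ ys) (suc-injective len) (y↦ , p) r) (sym y↦ , y≢)

  ∈-reducedWalks⁻ : ∀ l xs → xs ∈ reducedWalks l → (∃ λ u → ∃ λ v → IsWalk u v xs) × Reduced xs × length xs ≡ suc l
  ∈-reducedWalks⁻ l xs xs∈ = walk , reduced , length-∈-extend l (allOEdges G) xs xs∈
    where
    singleton : ∀ z → z ∈ singletons → ∃ λ o → z ≡ [ o ]
    singleton z z∈ = let o , _ , z≡ = ∈-map⁻ [_] z∈ in o , z≡
    IsSomeWalk : List O → Set
    IsSomeWalk z = ∃ λ u → ∃ λ v → IsWalk u v z
    walk : IsSomeWalk xs
    walk = extend-induction IsSomeWalk (λ _ o↝y (_ , v , _ , p) → _ , v , refl , sym (proj₁ o↝y) , p)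
             singletons (λ z z∈ → let o , z≡ = singleton z z∈ in subst IsSomeWalk (sym z≡) (ι o , τ o , refl , refl)) l xs xs∈
    reduced : Reduced xs
    reduced = extend-induction Reduced (λ _ o↝y r → proj₂ o↝y , r)
                singletons (λ z z∈ → let o , z≡ = singleton z z∈ in subst Reduced (sym z≡) tt) l xs xs∈

  reducedWalks-unique : ∀ l → Unique (reducedWalks l)
  reducedWalks-unique l = extend-unique l singletons (Unique.map⁺ List.∷-injectiveˡ allOEdges-unique)

  length-singletons : length singletons ≡ ∑ (nV G) (deg G)
  length-singletons = trans (List.length-map [_] (allOEdges G)) (sym ∑-deg)

  length-reducedWalks-≤ : ∀ d → (∀ v → deg G v ≤ d) → ∀ l → length (reducedWalks l) ≤ ∑ (nV G) (deg G) * (d ∸ 1) ^ l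
  length-reducedWalks-≤ d deg≤ l = subst (λ n → length (reducedWalks l) ≤ n * (d ∸ 1) ^ l) length-singletons
    (length-extend-≤ d deg≤ l singletons)

  length-reducedWalks-≡ : ∀ d → IsRegular G d → ∀ l → length (reducedWalks l) ≡ nV G * d * (d ∸ 1) ^ l
  length-reducedWalks-≡ d regular l = begin
    length (reducedWalks l)                 ≡⟨ length-extend-≡ d regular l (allOEdges G) ⟩
    length (allOEdges G) * (d ∸ 1) ^ l      ≡⟨ cong (_* (d ∸ 1) ^ l) ∑-deg ⟨
    ∑ (nV G) (deg G) * (d ∸ 1) ^ l          ≡⟨ cong (_* (d ∸ 1) ^ l) (trans (∑-cong (nV G) regular) (∑-const (nV G) d)) ⟩
    nV G * d * (d ∸ 1) ^ l                  ∎
    where open ≡-Reasoning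

  Reduced-∷? : ∀ o xs → Reduced xs → Dec (Reduced (o ∷ xs))
  Reduced-∷? o []       _ = yes tt
  Reduced-∷? o (x ∷ xs) r = map′ (_, r) proj₁ (¬? (x ≟ₒ ρ o))

  -- The reduced walks of length at most t that end at c and continue into tl without backtracking.
  module Ball (c : V) (tl : List O) (tl-reduced : Reduced tl) where

    Seed : O → Set
    Seed o = τ o ≡ c × Reduced (o ∷ tl)

    Seed? : ∀ o → Dec (Seed o)
    Seed? o = (τ o Fin.≟ c) ×-dec Reduced-∷? o tl tl-reduced

    seeds : List O
    seeds = filter Seed? (allOEdges G)

    ball : ℕ → List (List O)
    ball zero    = [ [] ]
    ball (suc t) = ball t ++ extend t (map [_] seeds)

    start : List O → V
    start []      = c
    start (o ∷ _) = ι o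

    start-IsWalk : ∀ {s} z → IsWalk s c z → start z ≡ s
    start-IsWalk []      p = sym p
    start-IsWalk (o ∷ z) p = proj₁ p

    InBall : List O → Set
    InBall z = IsWalk (start z) c z × Reduced (z ++ tl)

    private
      InBall-extend : ∀ l z → z ∈ extend l (map [_] seeds) → InBall z
      InBall-extend = extend-induction InBall (λ ys o↝y (p , r) → (refl , sym (proj₁ o↝y) , proj₂ p) , proj₂ o↝y , r)
        (map [_] seeds) seed-InBall
        where
        seed-InBall : ∀ z → z ∈ map [_] seeds → InBall z
        seed-InBall z z∈ with ∈-map⁻ [_] z∈
        ... | o , o∈ , refl = let o↦c , r = proj₂ (∈-filter⁻ Seed? {xs = allOEdges G} o∈)
                              in (refl , o↦c) , r

      ∈-extend-seeds⁺ : ∀ o zs → InBall (o ∷ zs) → (o ∷ zs) ∈ extend (length zs) (map [_] seeds)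
      ∈-extend-seeds⁺ o []       ((_ , o↦c) , r)          =
        ∈-map⁺ [_] (∈-filter⁺ Seed? (∈-allOEdges o) (o↦c , r))
      ∈-extend-seeds⁺ o (y ∷ ys) ((_ , y↦ , p) , (y≢ , r)) =
        ∈-extend⁺ (length ys) (map [_] seeds) ys (∈-extend-seeds⁺ y ys ((refl , p) , r)) (sym y↦ , y≢)

      ball-mono : ∀ {j} t {z} → j ≤ t → z ∈ ball j → z ∈ ball t
      ball-mono zero    z≤n z∈ = z∈
      ball-mono (suc t) j≤ z∈ with m≤n⇒m<n∨m≡n j≤
      ... | inj₁ (s≤s j≤t) = ∈-++⁺ˡ (ball-mono t j≤t z∈)
      ... | inj₂ refl      = z∈

    ∈-ball⁻ : ∀ t {z} → z ∈ ball t → InBall z × length z ≤ t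
    ∈-ball⁻ zero    (here refl) = (refl , tl-reduced) , z≤n
    ∈-ball⁻ (suc t) {z} z∈ with ∈-++⁻ (ball t) z∈
    ... | inj₁ z∈ball = let i , len = ∈-ball⁻ t z∈ball in i , m≤n⇒m≤1+n len
    ... | inj₂ z∈ext  = InBall-extend t z z∈ext , ≤-reflexive (length-∈-extend t seeds z z∈ext)

    ∈-ball⁺ : ∀ t z → InBall z → length z ≤ t → z ∈ ball t
    ∈-ball⁺ t []       _ _   = ball-mono t z≤n (here refl)
    ∈-ball⁺ t (o ∷ zs) i len = ball-mono t len (∈-++⁺ʳ (ball (length zs)) (∈-extend-seeds⁺ o zs i))

    ball-unique : ∀ t → Unique (ball t)
    ball-unique zero    = [] ∷ []
    ball-unique (suc t) = Unique.++⁺ (ball-unique t)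
      (extend-unique t (map [_] seeds) (Unique.map⁺ List.∷-injectiveˡ (Unique.filter⁺ _ allOEdges-unique)))
      (λ (z∈ball , z∈ext) → <-irrefl refl (≤-trans (≤-reflexive (sym (length-∈-extend t seeds _ z∈ext))) (proj₂ (∈-ball⁻ t z∈ball))))

    length-ball : ∀ d → IsRegular G d → ∀ t → length (ball t) ≡ 1 + length seeds * geomSum (d ∸ 1) t
    length-ball d regular zero    = cong suc (sym (*-zeroʳ (length seeds)))
    length-ball d regular (suc t) = begin
      length (ball t ++ extend t (map [_] seeds))               ≡⟨ List.length-++ (ball t) ⟩
      length (ball t) + length (extend t (map [_] seeds))       ≡⟨ cong₂ _+_ (length-ball d regular t) (length-extend-≡ d regular t seeds) ⟩
      1 + n * geomSum (d ∸ 1) t + n * (d ∸ 1) ^ t              ≡⟨ +-assoc 1 (n * geomSum (d ∸ 1) t) (n * (d ∸ 1) ^ t) ⟩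
      1 + (n * geomSum (d ∸ 1) t + n * (d ∸ 1) ^ t)            ≡⟨ cong (1 +_) (*-distribˡ-+ n (geomSum (d ∸ 1) t) ((d ∸ 1) ^ t)) ⟨
      1 + n * geomSum (d ∸ 1) (suc t)                          ∎
      where
      open ≡-Reasoning
      n = length seeds

    module _ {g} (gir : IsGirth G g) where
      open Girth gir

      ball-injective : ∀ t {z z′} → z ∈ ball t → z′ ∈ ball t → start z ≡ start z′ → t + t < g → z ≡ z′
      ball-injective t {z} {z′} z∈ z′∈ same-start short =
        reduced-walks-unique z z′ (proj₁ i) (Reduced-++⁻ˡ z tl (proj₂ i))
          (subst (λ u → IsWalk u c z′) (sym same-start) (proj₁ i′)) (Reduced-++⁻ˡ z′ tl (proj₂ i′))
          (≤-trans (s≤s (+-mono-≤ len len′)) short)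
        where
        i = proj₁ (∈-ball⁻ t z∈)
        len = proj₂ (∈-ball⁻ t z∈)
        i′ = proj₁ (∈-ball⁻ t z′∈)
        len′ = proj₂ (∈-ball⁻ t z′∈)

  length-seeds-vertex : ∀ x → length (Ball.seeds x [] tt) ≡ deg G x
  length-seeds-vertex x = trans (length-filter-rev _)
    (length-filter-cong _ (λ o → ι o Fin.≟ x) (λ o (ρo↦ , _) → trans (sym (term-rev o)) ρo↦) (λ o o↦ → trans (term-rev o) o↦ , tt)
      (allOEdges G))

  length-seeds-edge : ∀ f → length (Ball.seeds (ι f) [ f ] tt) ≡ deg G (ι f) ∸ 1
  length-seeds-edge f = begin
    length (Ball.seeds (ι f) [ f ] tt)
      ≡⟨ length-filter-cong _ (_↝? f) (λ o (o↦ , f≢ , _) → o↦ , f≢) (λ o (o↦ , f≢) → o↦ , f≢ , tt) (allOEdges G) ⟩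
    length (filter (_↝? f) (allOEdges G))         ≡⟨ List.length-map _ (filter (_↝? f) (allOEdges G)) ⟨
    length (extendBack [ f ])                     ≡⟨ length-extendBack f [] ⟩
    deg G (ι f) ∸ 1                               ∎
    where open ≡-Reasoning

  deg≥2 : ∀ {a b} → a ≢ b → ι a ≡ ι b → 2 ≤ deg G (ι a)
  deg≥2 {a} {b} a≢b same-init = subst (2 ≤_) (trans (+-comm 1 _) (sym (deg≡suc-otherOut a))) (s≤s (nonempty b∈))
    where
    b∈ : b ∈ otherOut a
    b∈ = ∈-filter⁺ (λ o → ι o Fin.≟ ι a ×-dec ¬? (o ≟ₒ a)) (∈-allOEdges b) (sym same-init , λ b≡a → a≢b (sym b≡a))
    nonempty : ∀ {x : O} {xs} → x ∈ xs → 1 ≤ length xs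
    nonempty (here _)  = s≤s z≤n
    nonempty (there _) = s≤s z≤n

  -- The kissing bound and its equality case

  module Kissing (m : ℕ) (gir : IsGirth G (suc m)) {k} (kiss : IsKissingNumber G (suc m) k) where
    open GirthCycles m gir public

    cycles : Fin k → Fin (suc m) → O
    cycles = Vec.lookup (proj₁ kiss)

    shortest : ∀ j → IsShortestCycle G (suc m) (cycles j)
    shortest = proj₁ (proj₂ kiss)

    inequivalent : ∀ i j → i ≢ j → ¬ CycEquiv G (suc m) (cycles i) (cycles j)
    inequivalent = proj₁ (proj₂ (proj₂ kiss))

    complete : ∀ w → IsShortestCycle G (suc m) w → ∃ λ j → CycEquiv G (suc m) (cycles j) w
    complete = proj₂ (proj₂ (proj₂ kiss))

    rotation : Fin k → Fin (suc m) → ℕ → O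
    rotation j r n = cyclic (cycles j) (n + toℕ r)

    ReducedSeq-rotation : ∀ j r → ReducedSeq (rotation j r)
    ReducedSeq-rotation j r n = ReducedSeq-cyclic (cycles j) (proj₂ (shortest j)) (n + toℕ r)

    rotation-periodic : ∀ j r → rotation j r (suc m) ≡ rotation j r 0
    rotation-periodic j r = trans (cong (cyclic (cycles j)) (+-comm (suc m) (toℕ r))) (cyclic-periodic (cycles j) (toℕ r))

    arc : Fin k → Fin (suc m) → List O
    arc j r = window (rotation j r) 0 (suc h)

    IsWalk-arc : ∀ j r → IsWalk (ι (rotation j r 0)) (ι (rotation j r (suc h))) (arc j r)
    IsWalk-arc j r = IsWalk-window (rotation j r) 0 (suc h) (ReducedSeq-rotation j r)

    arc∈reducedWalks : ∀ j r → arc j r ∈ reducedWalks h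
    arc∈reducedWalks j r = ∈-reducedWalks⁺ h (arc j r) (length-window (rotation j r) 0 (suc h)) (IsWalk-arc j r)
      (Reduced-window (rotation j r) 0 (suc h) (ReducedSeq-rotation j r))

    rotations-agree⇒equivalent : ∀ j j′ r r′ → (∀ n → n < suc m → rotation j r n ≡ rotation j′ r′ n) →
                                 CycEquiv G (suc m) (cycles j) (cycles j′)
    rotations-agree⇒equivalent j j′ r r′ agree = shift , λ i → sym (same i)
      where
      x = suc m ∸ toℕ r′
      x+r′≡g : x + toℕ r′ ≡ suc m
      x+r′≡g = m∸n+n≡m (<⇒≤ (Fin.toℕ<n r′))
      -- r − r′ modulo the girth
      shift : Fin (suc m)
      shift = (x + toℕ r) mod suc m
      same : ∀ i → cycles j (rot shift i) ≡ cycles j′ i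
      same i = begin
        cyclic (cycles j) (toℕ i + toℕ shift) ≡⟨ cyclic-cong (cycles j) (toℕ i + toℕ shift) (n + toℕ r) shift≡ ⟩
        rotation j r n                        ≡⟨ agree n (m%n<n (toℕ i + x) (suc m)) ⟩
        rotation j′ r′ n                      ≡⟨ cyclic-cong (cycles j′) (n + toℕ r′) (toℕ i) unshift≡ ⟩
        cyclic (cycles j′) (toℕ i)            ≡⟨ cyclic-toℕ (cycles j′) i ⟩
        cycles j′ i                           ∎
        where
        open ≡-Reasoning
        n = (toℕ i + x) % suc m
        shift≡ : (toℕ i + toℕ shift) % suc m ≡ (n + toℕ r) % suc m
        shift≡ = begin
          (toℕ i + toℕ shift) % suc m            ≡⟨ cong (λ a → (toℕ i + a) % suc m) (toℕ-mod (x + toℕ r) m) ⟩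
          (toℕ i + (x + toℕ r) % suc m) % suc m  ≡⟨ [m+k%n]%n≡[m+k]%n (toℕ i) (x + toℕ r) (suc m) ⟩
          (toℕ i + (x + toℕ r)) % suc m          ≡⟨ cong (_% suc m) (+-assoc (toℕ i) x (toℕ r)) ⟨
          (toℕ i + x + toℕ r) % suc m            ≡⟨ [m%n+k]%n≡[m+k]%n (toℕ i + x) (toℕ r) (suc m) ⟨
          (n + toℕ r) % suc m                    ∎
        unshift≡ : (n + toℕ r′) % suc m ≡ toℕ i % suc m
        unshift≡ = begin
          (n + toℕ r′) % suc m                   ≡⟨ [m%n+k]%n≡[m+k]%n (toℕ i + x) (toℕ r′) (suc m) ⟩
          (toℕ i + x + toℕ r′) % suc m           ≡⟨ cong (_% suc m) (trans (+-assoc (toℕ i) x (toℕ r′)) (cong (toℕ i +_) x+r′≡g)) ⟩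
          (toℕ i + suc m) % suc m                ≡⟨ [m+n]%n≡m%n (toℕ i) (suc m) ⟩
          toℕ i % suc m                          ∎

    arc-injective : ∀ {j j′ r r′} → arc j r ≡ arc j′ r′ → j ≡ j′ × r ≡ r′
    arc-injective {j} {j′} {r} {r′} same-arc = same-cycle , same-rotation
      where
      agree-on-arc : ∀ n → n ≤ h → rotation j r n ≡ rotation j′ r′ n
      agree-on-arc n n≤h = window-injective (rotation j r) (rotation j′ r′) 0 (suc h) same-arc n (s≤s n≤h)
      same-cycle : j ≡ j′
      same-cycle with j Fin.≟ j′
      ... | yes j≡j′ = j≡j′
      ... | no  j≢j′ = contradiction
        (rotations-agree⇒equivalent j j′ r r′ (agree-on-half⇒agree (rotation j r) (rotation j′ r′)
          (ReducedSeq-rotation j r) (ReducedSeq-rotation j′ r′) (rotation-periodic j r) (rotation-periodic j′ r′) agree-on-arc))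
        (inequivalent j j′ j≢j′)
      same-rotation : r ≡ r′
      same-rotation = proj₂ (proj₁ (shortest j′)) (cong ι (begin
        cycles j′ r              ≡⟨ cyclic-toℕ (cycles j′) r ⟨
        rotation j′ r 0          ≡⟨ cong (λ i → rotation i r 0) same-cycle ⟨
        rotation j r 0           ≡⟨ agree-on-arc 0 z≤n ⟩
        rotation j′ r′ 0         ≡⟨ cyclic-toℕ (cycles j′) r′ ⟩
        cycles j′ r′             ∎))
        where open ≡-Reasoning

    arcAt : Fin (suc m * k) → List O
    arcAt i = let r , j = remQuot k i in arc j r

    arcAt-injective : Injective _≡_ _≡_ arcAt
    arcAt-injective {i} {i′} same-arc = begin
      i                                     ≡⟨ Fin.combine-remQuot {suc m} k i ⟨
      uncurry combine (remQuot k i)         ≡⟨ cong (uncurry combine) (cong₂ _,_ (proj₂ same) (proj₁ same)) ⟩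
      uncurry combine (remQuot k i′)        ≡⟨ Fin.combine-remQuot {suc m} k i′ ⟩
      i′                                    ∎
      where
      open ≡-Reasoning
      same = arc-injective {proj₂ (remQuot k i)} {proj₂ (remQuot k i′)} same-arc

    girth*k≤#reducedWalks : suc m * k ≤ length (reducedWalks h)
    girth*k≤#reducedWalks = injection⇒≤length arcAt arcAt-injective (λ i → arc∈reducedWalks _ _)

    IsArc : List O → Set
    IsArc W = ∃ λ j → ∃ λ r → arc j r ≡ W

    module _ {d} (deg≤ : ∀ v → deg G v ≤ d) where

      #reducedWalks≤ : length (reducedWalks h) ≤ nV G * d * (d ∸ 1) ^ h
      #reducedWalks≤ = ≤-trans (length-reducedWalks-≤ d deg≤ h) (*-monoˡ-≤ ((d ∸ 1) ^ h) (∑-≤ (nV G) (deg G) d deg≤))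

      kissing-bound : suc m * k ≤ nV G * d * (d ∸ 1) ^ h
      kissing-bound = ≤-trans girth*k≤#reducedWalks #reducedWalks≤

    Attains : ℕ → Set
    Attains d = suc m * k ≡ nV G * d * (d ∸ 1) ^ h

    all-arcs⇒attains : ∀ {d} → IsRegular G d → (∀ {W} → W ∈ reducedWalks h → IsArc W) → Attains d
    all-arcs⇒attains {d} regular all-arcs = ≤-antisym (kissing-bound (≤-reflexive ∘ regular)) (begin
      nV G * d * (d ∸ 1) ^ h    ≡⟨ length-reducedWalks-≡ d regular h ⟨
      length (reducedWalks h)   ≤⟨ injectiveOn⇒length≤ (reducedWalks-unique h) label label-injective ⟩
      suc m * k                 ∎)
      where
      open ≤-Reasoning
      label : ∀ {W} → W ∈ reducedWalks h → Fin (suc m * k)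
      label W∈ = let j , r , _ = all-arcs W∈ in combine r j
      label-injective : ∀ {W W′} (p : W ∈ reducedWalks h) (q : W′ ∈ reducedWalks h) → label p ≡ label q → W ≡ W′
      label-injective p q same-label with all-arcs p | all-arcs q
      ... | j , r , refl | j′ , r′ , refl with Fin.combine-injective r j r′ j′ same-label
      ...   | refl , refl = refl

    Closable : Set
    Closable = ∀ {u v} W → length W ≡ suc h → IsWalk u v W → Reduced W →
               ∃ λ R → IsWalk v u R × length R ≡ suc m ∸ suc h

    module Attained {d} (maxDeg : IsMaxDegree G d) (attained : Attains d) where

      all-arcs : ∀ {W} → W ∈ reducedWalks h → IsArc W
      all-arcs W∈ =
        let i , arc≡W = injection⇒surjective arcAt arcAt-injective (λ _ → arc∈reducedWalks _ _)
                          (≤-trans (#reducedWalks≤ (proj₁ maxDeg)) (≤-reflexive (sym attained))) W∈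
        in proj₂ (remQuot k i) , proj₁ (remQuot k i) , arc≡W

      2≤d : 2 ≤ d
      2≤d = ≤-trans (deg≥2 (geodesic fz) (trans (sym (closed fz)) (sym (init-rev (w fz))))) (proj₁ maxDeg _)
        where
        w = proj₁ (proj₁ (proj₂ gir))
        closed = proj₁ (proj₂ (proj₁ (proj₂ gir)))
        geodesic = proj₂ (proj₂ (proj₁ (proj₂ gir)))

      regular : IsRegular G d
      regular = ∑-≡-*⇒≡ (nV G) (deg G) d (proj₁ maxDeg) ∑deg≡
        where
        instance
          power≢0 : NonZero ((d ∸ 1) ^ h)
          power≢0 = m^n≢0 (d ∸ 1) h {{>-nonZero (∸-monoˡ-≤ 1 2≤d)}}
        ∑deg≡ : ∑ (nV G) (deg G) ≡ nV G * d
        ∑deg≡ = *-cancelʳ-≡ _ _ ((d ∸ 1) ^ h) (≤-antisym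
          (*-monoˡ-≤ ((d ∸ 1) ^ h) (∑-≤ (nV G) (deg G) d (proj₁ maxDeg)))
          (begin
            nV G * d * (d ∸ 1) ^ h          ≡⟨ attained ⟨
            suc m * k                       ≤⟨ girth*k≤#reducedWalks ⟩
            length (reducedWalks h)         ≤⟨ length-reducedWalks-≤ d (proj₁ maxDeg) h ⟩
            ∑ (nV G) (deg G) * (d ∸ 1) ^ h  ∎))
          where open ≤-Reasoning

      closable : Closable
      closable {u} {v} W len p r = window F (suc h) x , walk , length-window F (suc h) x
        where
        W-arc = all-arcs (∈-reducedWalks⁺ h W len p r)
        j = proj₁ W-arc
        r′ = proj₁ (proj₂ W-arc)
        x = suc m ∸ suc h
        F = rotation j r′
        p′ : IsWalk u v (arc j r′)
        p′ = subst (IsWalk u v) (sym (proj₂ (proj₂ W-arc))) p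
        walk : IsWalk v u (window F (suc h) x)
        walk = subst₂ (λ a b → IsWalk a b (window F (suc h) x))
          (IsWalk-target (arc j r′) (IsWalk-arc j r′) (subst (λ a → IsWalk a v (arc j r′)) (sym (proj₁ p′)) p′))
          (trans (cong (ι ∘ F) (m+[n∸m]≡n h<girth)) (trans (cong ι (rotation-periodic j r′)) (proj₁ p′)))
          (IsWalk-window F (suc h) x (ReducedSeq-rotation j r′))

    short-closed⇒arc : ∀ {u} W q → 1 ≤ length W → IsWalk u u (W ++ q) → Reduced (W ++ q) →
                       length (W ++ q) ≤ suc m → length W ≡ suc h → IsArc W
    short-closed⇒arc (w ∷ W) q _ p r ≤g len = j , r′ , (begin
      window (rotation j r′) 0 (suc h)     ≡⟨ window-cong (rotation j r′) F 0 (suc h) agree ⟩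
      window F 0 (suc h)                   ≡⟨ cong (window F 0) len ⟨
      window F 0 (length (w ∷ W))          ≡⟨ window-lookupOr w (w ∷ W) q ⟩
      w ∷ W                                ∎)
      where
      open ≡-Reasoning
      F = lookupOr w (w ∷ W ++ q)
      geodesic = short-closed⇒closedGeodesic w (W ++ q) p r ≤g
      c : Fin (suc m) → O
      c = F ∘ toℕ
      c-geodesic : IsClosedGeodesic G (suc m) c
      c-geodesic = subst (λ n → IsClosedGeodesic G n (F ∘ toℕ)) (proj₁ geodesic) (proj₂ geodesic)
      c-rotation = complete c (closedGeodesic⇒cycle c c-geodesic , c-geodesic)
      j = proj₁ c-rotation
      r′ = proj₁ (proj₂ c-rotation)
      agree : ∀ n → n < suc h → rotation j r′ n ≡ F n
      agree n n<h = begin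
        cyclic (cycles j) (n + toℕ r′)                  ≡⟨ cong (λ a → cyclic (cycles j) (a + toℕ r′)) (Fin.toℕ-fromℕ< n<g) ⟨
        cycles j (rot r′ (fromℕ< n<g))                   ≡⟨ proj₂ (proj₂ c-rotation) (fromℕ< n<g) ⟨
        F (toℕ (fromℕ< n<g))                             ≡⟨ cong F (Fin.toℕ-fromℕ< n<g) ⟩
        F n                                              ∎
        where
        n<g : n < suc m
        n<g = ≤-trans n<h h<girth

    -- Replace the last h + 1 edges of P by the reversed closing walk, then remove backtracks.
    shortcut : Closable → ∀ {s y} P → IsWalk s y P → Reduced P → suc h ≤ length P →
               ∃ λ Q → IsWalk s y Q × Reduced Q × length Q + suc h ≤ length P + (suc m ∸ suc h)
    shortcut close P p r h<P with splitAt-suffix P (suc h) h<P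
    ... | P₀ , P₁ , refl , len₁ = Q , walk , reduced , (begin
      length Q + suc h                           ≤⟨ +-monoˡ-≤ (suc h) shorter ⟩
      length (P₀ ++ reverseWalk R) + suc h       ≡⟨ cong (_+ suc h) (List.length-++ P₀) ⟩
      length P₀ + length (reverseWalk R) + suc h ≡⟨ cong (λ a → length P₀ + a + suc h) (trans (length-reverseWalk R) len-R) ⟩
      length P₀ + x + suc h                      ≡⟨ +-assoc (length P₀) x (suc h) ⟩
      length P₀ + (x + suc h)                    ≡⟨ cong (length P₀ +_) (+-comm x (suc h)) ⟩
      length P₀ + (suc h + x)                    ≡⟨ +-assoc (length P₀) (suc h) x ⟨
      length P₀ + suc h + x                      ≡⟨ cong (λ a → length P₀ + a + x) len₁ ⟨
      length P₀ + length P₁ + x                  ≡⟨ cong (_+ x) (List.length-++ P₀) ⟨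
      length (P₀ ++ P₁) + x                      ∎)
      where
      open ≤-Reasoning
      x = suc m ∸ suc h
      split = IsWalk-++⁻ P₀ p
      closing = close P₁ len₁ (proj₂ (proj₂ split)) (Reduced-++⁻ʳ P₀ P₁ r)
      R = proj₁ closing
      len-R = proj₂ (proj₂ closing)
      reduction = reduce (P₀ ++ reverseWalk R) (IsWalk-++ P₀ (proj₁ (proj₂ split)) (IsWalk-reverse R (proj₁ (proj₂ closing))))
      Q = proj₁ reduction
      walk = proj₁ (proj₂ reduction)
      reduced = proj₁ (proj₂ (proj₂ reduction))
      shorter = proj₂ (proj₂ (proj₂ reduction))

    closing⇒arc : ∀ {u v} W → IsWalk u v W → Reduced W → length W ≡ suc h →
                  ∀ z → IsWalk v u z → Reduced z → length z ≤ h → length z + h < suc m → IsArc W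
    closing⇒arc W p r len z pz rz z≤h short with initLast W
    ... | []       = case len of λ ()
    ... | ws ∷ʳ′ a = short-closed⇒arc (ws ∷ʳ a) z
      (subst (1 ≤_) (sym (length-∷ʳ ws a)) (s≤s z≤n)) (IsWalk-++ (ws ∷ʳ a) p pz)
      (Reduced-++-short ws a z p r pz rz (subst (length z ≤_) (sym ws≡h) z≤h) (<⇒≤ (subst (λ n → length z + n < suc m) (sym ws≡h) short)))
      length≤ len
      where
      ws≡h : length ws ≡ h
      ws≡h = suc-injective (trans (sym (length-∷ʳ ws a)) len)
      length≤ : length ((ws ∷ʳ a) ++ z) ≤ suc m
      length≤ = begin
        length ((ws ∷ʳ a) ++ z)        ≡⟨ List.length-++ (ws ∷ʳ a) ⟩
        length (ws ∷ʳ a) + length z    ≡⟨ cong (_+ length z) len ⟩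
        suc (h + length z)             ≡⟨ cong suc (+-comm h (length z)) ⟩
        suc (length z + h)             ≤⟨ short ⟩
        suc m                          ∎
        where open ≤-Reasoning

    -- Moore graphs

    module OddGirth (t : ℕ) (m≡2t : m ≡ t + t) where

      h≡t : h ≡ t
      h≡t = trans (cong (λ a → ⌊ suc a /2⌋) m≡2t) (sym (n≡⌈n+n/2⌉ t))

      2t<girth : t + t < suc m
      2t<girth = s≤s (≤-reflexive (sym m≡2t))

      module Centred (c : V) where
        open Ball c [] tt public

        ball-injective′ : ∀ {z z′} → z ∈ ball t → z′ ∈ ball t → start z ≡ start z′ → z ≡ z′
        ball-injective′ z∈ z′∈ same-start = ball-injective gir t z∈ z′∈ same-start 2t<girth

        length-ball≤n : length (ball t) ≤ nV G
        length-ball≤n = injectiveOn⇒length≤ (ball-unique t) (λ {z} _ → start z) (λ p q → ball-injective′ p q)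

        length-ball≡moore : ∀ {d} → IsRegular G d → length (ball t) ≡ mooreCount d (suc m)
        length-ball≡moore {d} regular = begin
          length (ball t)                               ≡⟨ length-ball d regular t ⟩
          1 + length seeds * geomSum (d ∸ 1) t          ≡⟨ cong (λ a → 1 + a * geomSum (d ∸ 1) t) (trans (length-seeds-vertex c) (regular c)) ⟩
          1 + d * geomSum (d ∸ 1) t                     ≡⟨ mooreCount-odd d t ⟨
          mooreCount d (suc (t + t))                    ≡⟨ cong (mooreCount d ∘ suc) m≡2t ⟨
          mooreCount d (suc m)                          ∎
          where open ≡-Reasoning

        InBall⇒walk : ∀ {z} → InBall z → IsWalk (start z) c z × Reduced z
        InBall⇒walk {z} (p , r) = p , subst Reduced (List.++-identityʳ z) r

        reach : Closable → Connected G → ∀ v → ∃ λ z → z ∈ ball t × start z ≡ v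
        reach close conn v = let P , p , r = connected⇒reducedWalk conn v c in go (length P) P ≤-refl p r
          where
          go : ∀ n P → length P ≤ n → IsWalk v c P → Reduced P → ∃ λ z → z ∈ ball t × start z ≡ v
          go n P P≤n p r with length P ≤? t
          ... | yes P≤t = P , ∈-ball⁺ t P (subst (λ u → IsWalk u c P) (sym (start-IsWalk P p)) p , subst Reduced (sym (List.++-identityʳ P)) r) P≤t
                            , start-IsWalk P p
          go zero    P P≤n p r | no P≰t = contradiction (≤-trans P≤n z≤n) P≰t
          go (suc n) P P≤n p r | no P≰t =
            let Q , q , rQ , bound = shortcut close P p r (subst (_≤ length P) (cong suc (sym h≡t)) (≰⇒> P≰t))
            in go n Q (≤-pred (≤-trans (Q<P Q bound) P≤n)) q rQ
            where
            Q<P : ∀ Q → length Q + suc h ≤ length P + (suc m ∸ suc h) → length Q < length P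
            Q<P Q bound = +-cancelʳ-≤ t (suc (length Q)) (length P) (begin
              suc (length Q) + t         ≡⟨ +-suc (length Q) t ⟨
              length Q + suc t           ≡⟨ cong (λ a → length Q + suc a) h≡t ⟨
              length Q + suc h           ≤⟨ bound ⟩
              length P + (suc m ∸ suc h) ≡⟨ cong (λ a → length P + (suc a ∸ suc h)) m≡2t ⟩
              length P + (t + t ∸ h)     ≡⟨ cong (λ a → length P + (t + t ∸ a)) h≡t ⟩
              length P + (t + t ∸ t)     ≡⟨ cong (length P +_) (m+n∸n≡m t t) ⟩
              length P + t               ∎)
              where open ≤-Reasoning

      closable⇒moore : Closable → Connected G → ∀ {d} → IsRegular G d → nV G ≡ mooreCount d (suc m)
      closable⇒moore close conn regular =
        trans (≤-antisym (surjectiveOn⇒≤length start (ball t) (reach close conn)) length-ball≤n) (length-ball≡moore regular)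
        where open Centred basepoint

      moore⇒all-arcs : ∀ {d} → IsRegular G d → nV G ≡ mooreCount d (suc m) → ∀ {W} → W ∈ reducedWalks h → IsArc W
      moore⇒all-arcs regular moore {W} W∈ with ∈-reducedWalks⁻ h W W∈
      ... | (u , v , p) , r , len = closing⇒arc W p r len z pz rz (subst (length z ≤_) (sym h≡t) z≤t) short
        where
        open Centred u
        covers = injectiveOn⇒surjective (ball-unique t) (λ {z} _ → start z) (λ p q → ball-injective′ p q)
                   (≤-reflexive (trans moore (sym (length-ball≡moore regular)))) v
        z = proj₁ covers
        in-ball = ∈-ball⁻ t (proj₁ (proj₂ covers))
        z≤t = proj₂ in-ball
        pz : IsWalk v u z
        pz = subst (λ s → IsWalk s u z) (proj₂ (proj₂ covers)) (proj₁ (InBall⇒walk (proj₁ in-ball)))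
        rz = proj₂ (InBall⇒walk (proj₁ in-ball))
        short : length z + h < suc m
        short = subst (λ n → length z + n < suc m) (sym h≡t) (≤-trans (s≤s (+-monoˡ-≤ t z≤t)) 2t<girth)

    module EvenGirth (t : ℕ) (m≡2t+1 : m ≡ suc (t + t)) where

      h≡t+1 : h ≡ suc t
      h≡t+1 = trans (cong (λ a → ⌊ suc a /2⌋) m≡2t+1) (cong suc (sym (n≡⌊n+n/2⌋ t)))

      2t+1<girth : suc (t + t) < suc m
      2t+1<girth = s≤s (≤-reflexive (sym m≡2t+1))

      module Centred (e : O) where
        module Bₑ = Ball (ι e) [ e ] tt
        module Bᵣ = Ball (ι (ρ e)) [ ρ e ] tt

        balls : List (List O ⊎ List O)
        balls = map inj₁ (Bₑ.ball t) ++ map inj₂ (Bᵣ.ball t)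

        start : List O ⊎ List O → V
        start (inj₁ z) = Bₑ.start z
        start (inj₂ z) = Bᵣ.start z

        ∈-balls⁻ : ∀ {a} → a ∈ balls → (∃ λ z → z ∈ Bₑ.ball t × a ≡ inj₁ z) ⊎ (∃ λ z → z ∈ Bᵣ.ball t × a ≡ inj₂ z)
        ∈-balls⁻ a∈ with ∈-++⁻ (map inj₁ (Bₑ.ball t)) a∈
        ... | inj₁ a∈ₑ = inj₁ (∈-map⁻ inj₁ a∈ₑ)
        ... | inj₂ a∈ᵣ = inj₂ (∈-map⁻ inj₂ a∈ᵣ)

        balls-unique : Unique balls
        balls-unique = Unique.++⁺ (Unique.map⁺ Sum.inj₁-injective (Bₑ.ball-unique t)) (Unique.map⁺ Sum.inj₂-injective (Bᵣ.ball-unique t))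
          λ (a∈ₑ , a∈ᵣ) → disjoint (∈-map⁻ inj₁ a∈ₑ) (∈-map⁻ inj₂ a∈ᵣ)
          where
          disjoint : ∀ {a : List O ⊎ List O} →
                     (∃ λ z → z ∈ Bₑ.ball t × a ≡ inj₁ z) → (∃ λ z → z ∈ Bᵣ.ball t × a ≡ inj₂ z) → ⊥
          disjoint (_ , _ , refl) (_ , _ , ())

        -- A walk of the e-ball followed by e and a walk of the ρ e-ball with the same start would be
        -- two distinct short reduced walks to the terminal vertex of e.
        no-cross : ∀ {z z′} → z ∈ Bₑ.ball t → z′ ∈ Bᵣ.ball t → Bₑ.start z ≢ Bᵣ.start z′
        no-cross {z} {z′} z∈ z′∈ same-start = Reduced-++-backtrack z e (ρ e) [] reduced-twice refl
          where
          in-ball = Bₑ.∈-ball⁻ t z∈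
          in-ball′ = Bᵣ.∈-ball⁻ t z′∈
          same : z ∷ʳ e ≡ z′
          same = reduced-walks-unique (z ∷ʳ e) z′
            (IsWalk-++ z (proj₁ (proj₁ in-ball)) (refl , refl)) (proj₂ (proj₁ in-ball))
            (subst₂ (λ a b → IsWalk a b z′) (sym same-start) (init-rev e) (proj₁ (proj₁ in-ball′)))
            (Reduced-++⁻ˡ z′ [ ρ e ] (proj₂ (proj₁ in-ball′)))
            (begin-strict
              length (z ∷ʳ e) + length z′  ≡⟨ cong (_+ length z′) (length-∷ʳ z e) ⟩
              suc (length z + length z′)   ≤⟨ s≤s (+-mono-≤ (proj₂ in-ball) (proj₂ in-ball′)) ⟩
              suc (t + t)                  <⟨ 2t+1<girth ⟩
              suc m                        ∎)
            where open ≤-Reasoning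
          reduced-twice : Reduced (z ++ e ∷ ρ e ∷ [])
          reduced-twice = subst Reduced (trans (cong (_++ [ ρ e ]) (sym same)) (List.++-assoc z [ e ] [ ρ e ])) (proj₂ (proj₁ in-ball′))

        balls-injective : ∀ {a b} → a ∈ balls → b ∈ balls → start a ≡ start b → a ≡ b
        balls-injective a∈ b∈ same-start with ∈-balls⁻ a∈ | ∈-balls⁻ b∈
        ... | inj₁ (z , z∈ , refl) | inj₁ (z′ , z′∈ , refl) =
          cong inj₁ (Bₑ.ball-injective gir t z∈ z′∈ same-start (≤-trans (n≤1+n _) 2t+1<girth))
        ... | inj₂ (z , z∈ , refl) | inj₂ (z′ , z′∈ , refl) =
          cong inj₂ (Bᵣ.ball-injective gir t z∈ z′∈ same-start (≤-trans (n≤1+n _) 2t+1<girth))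
        ... | inj₁ (z , z∈ , refl) | inj₂ (z′ , z′∈ , refl) = contradiction same-start (no-cross z∈ z′∈)
        ... | inj₂ (z , z∈ , refl) | inj₁ (z′ , z′∈ , refl) = contradiction (sym same-start) (no-cross z′∈ z∈)

        length-balls≤n : length balls ≤ nV G
        length-balls≤n = injectiveOn⇒length≤ balls-unique (λ {a} _ → start a) (λ p q → balls-injective p q)

        length-balls≡moore : ∀ {d} → IsRegular G d → length balls ≡ mooreCount d (suc m)
        length-balls≡moore {d} regular = begin
          length balls                                            ≡⟨ List.length-++ (map inj₁ (Bₑ.ball t)) ⟩
          length (map inj₁ (Bₑ.ball t)) + length (map inj₂ (Bᵣ.ball t))
            ≡⟨ cong₂ _+_ (List.length-map inj₁ (Bₑ.ball t)) (List.length-map inj₂ (Bᵣ.ball t)) ⟩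
          length (Bₑ.ball t) + length (Bᵣ.ball t)                 ≡⟨ cong₂ _+_ (length-half e) (length-half (ρ e)) ⟩
          geomSum (d ∸ 1) (suc t) + geomSum (d ∸ 1) (suc t)       ≡⟨ cong (geomSum (d ∸ 1) (suc t) +_) (+-identityʳ _) ⟨
          2 * geomSum (d ∸ 1) (suc t)                             ≡⟨ mooreCount-even d t ⟨
          mooreCount d (suc (suc (t + t)))                        ≡⟨ cong (mooreCount d ∘ suc) m≡2t+1 ⟨
          mooreCount d (suc m)                                    ∎
          where
          open ≡-Reasoning
          length-half : ∀ f → length (Ball.ball (ι f) [ f ] tt t) ≡ geomSum (d ∸ 1) (suc t)
          length-half f = begin
            length (Ball.ball (ι f) [ f ] tt t)                             ≡⟨ Ball.length-ball (ι f) [ f ] tt d regular t ⟩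
            1 + length (Ball.seeds (ι f) [ f ] tt) * geomSum (d ∸ 1) t
              ≡⟨ cong (λ a → 1 + a * geomSum (d ∸ 1) t) (trans (length-seeds-edge f) (cong (_∸ 1) (regular (ι f)))) ⟩
            1 + (d ∸ 1) * geomSum (d ∸ 1) t                                 ≡⟨ geomSum-suc (d ∸ 1) t ⟨
            geomSum (d ∸ 1) (suc t)                                         ∎


      moore⇒all-arcs : ∀ {d} → IsRegular G d → nV G ≡ mooreCount d (suc m) → ∀ {W} → W ∈ reducedWalks h → IsArc W
      moore⇒all-arcs regular moore {W} W∈ with ∈-reducedWalks⁻ h W W∈
      moore⇒all-arcs regular moore {w ∷ W} W∈ | (u , v , p) , r , len = from-ball (∈-balls⁻ (proj₁ (proj₂ covers))) (proj₂ (proj₂ covers))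
        where
        open Centred w
        covers = injectiveOn⇒surjective balls-unique (λ {a} _ → start a) (λ p q → balls-injective p q)
                   (≤-reflexive (trans moore (sym (length-balls≡moore regular)))) v
        from-ball : ∀ {a} → (∃ λ z → z ∈ Bₑ.ball t × a ≡ inj₁ z) ⊎ (∃ λ z → z ∈ Bᵣ.ball t × a ≡ inj₂ z) →
                    start a ≡ v → IsArc (w ∷ W)
        from-ball (inj₁ (z , z∈ , refl)) start≡ = closing⇒arc (w ∷ W) p r len z
          (subst₂ (λ a b → IsWalk a b z) start≡ (proj₁ p) (proj₁ (proj₁ in-ball))) (Reduced-++⁻ˡ z [ w ] (proj₂ (proj₁ in-ball)))
          (≤-trans (proj₂ in-ball) (≤-trans (n≤1+n t) (≤-reflexive (sym h≡t+1))))
          (subst (λ n → length z + n < suc m) (sym h≡t+1)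
            (≤-trans (s≤s (≤-reflexive (+-suc (length z) t))) (≤-trans (s≤s (s≤s (+-monoˡ-≤ t (proj₂ in-ball)))) 2t+1<girth)))
          where in-ball = Bₑ.∈-ball⁻ t z∈
        from-ball (inj₂ (z , z∈ , refl)) start≡ with initLast W
        ... | []       = case trans (suc-injective len) h≡t+1 of λ ()
        ... | ws ∷ʳ′ a = contradiction (girth≤closing ws a z (proj₂ p) (Reduced-tail (ws ∷ʳ a) r) pz rz z≤ws ≤g) (<⇒≱ closing<g)
          where
          in-ball = Bᵣ.∈-ball⁻ t z∈
          pz : IsWalk v (τ w) z
          pz = subst₂ (λ a b → IsWalk a b z) start≡ (init-rev w) (proj₁ (proj₁ in-ball))
          rz = Reduced-++⁻ˡ z [ ρ w ] (proj₂ (proj₁ in-ball))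
          ws≡t : length ws ≡ t
          ws≡t = suc-injective (trans (sym (length-∷ʳ ws a)) (trans (suc-injective len) h≡t+1))
          z≤ws : length z ≤ length ws
          z≤ws = ≤-trans (proj₂ in-ball) (≤-reflexive (sym ws≡t))
          ≤g : length z + length ws ≤ suc m
          ≤g = ≤-trans (+-mono-≤ (proj₂ in-ball) (≤-reflexive ws≡t)) (≤-trans (n≤1+n _) (<⇒≤ 2t+1<girth))
          closing<g : length ((ws ∷ʳ a) ++ z) < suc m
          closing<g = begin-strict
            length ((ws ∷ʳ a) ++ z)       ≡⟨ List.length-++ (ws ∷ʳ a) ⟩
            length (ws ∷ʳ a) + length z   ≡⟨ cong (_+ length z) (trans (length-∷ʳ ws a) (cong suc ws≡t)) ⟩
            suc (t + length z)            ≤⟨ s≤s (+-monoʳ-≤ t (proj₂ in-ball)) ⟩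
            suc (t + t)                   <⟨ 2t+1<girth ⟩
            suc m                         ∎
            where open ≤-Reasoning

      Shape : O → V → List O → Set
      Shape f s P = IsWalk s (ι f) P × Reduced (P ∷ʳ f)

      classify : ∀ f {s} Q → IsWalk s (τ f) Q → Reduced Q →
                 Shape (ρ f) s Q ⊎ ∃ λ Q′ → Shape f s Q′ × length Q′ < length Q
      classify f Q q r with initLast Q
      ... | []       = inj₁ (trans q (sym (init-rev f)) , tt)
      ... | ys ∷ʳ′ a with a ≟ₒ f
      ...   | yes refl = inj₂ (ys , (ys-walk , r) , ≤-reflexive (sym (length-∷ʳ ys a)))
        where
        split = IsWalk-++⁻ ys q
        ys-walk : IsWalk _ (ι a) ys
        ys-walk = subst (λ w → IsWalk _ w ys) (sym (proj₁ (proj₂ (proj₂ split)))) (proj₁ (proj₂ split))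
      ...   | no  a≢f  = inj₁ (subst (λ w → IsWalk _ w (ys ∷ʳ a)) (sym (init-rev f)) q ,
                               Reduced-++ (ys ∷ʳ a) [] r tt (Continues-∷ʳ ys a (λ ρf≡ρa → a≢f (sym (rev-injective ρf≡ρa)))))

      module _ (close : Closable) where

        shorten : ∀ f {s} P → Shape f s P → suc t ≤ length P →
                  ∃ λ Q → (Shape (ρ f) s Q ⊎ Shape f s Q) × length Q < length P
        shorten f {s} P (p , r) t<P =
          let Q , q , rQ , bound = shortcut close (P ∷ʳ f) (IsWalk-++ P p (refl , refl)) r h<P
          in finish (Q<P Q bound) (classify f Q q rQ)
          where
          h<P : suc h ≤ length (P ∷ʳ f)
          h<P = subst₂ _≤_ (cong suc (sym h≡t+1)) (sym (length-∷ʳ P f)) (s≤s t<P)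
          Q<P : ∀ Q → length Q + suc h ≤ length (P ∷ʳ f) + (suc m ∸ suc h) → length Q < length P
          Q<P Q bound = +-cancelʳ-≤ (suc t) (suc (length Q)) (length P) (begin
            suc (length Q) + suc t             ≡⟨ +-suc (length Q) (suc t) ⟨
            length Q + suc (suc t)             ≡⟨ cong (λ a → length Q + suc a) h≡t+1 ⟨
            length Q + suc h                   ≤⟨ bound ⟩
            length (P ∷ʳ f) + (suc m ∸ suc h)  ≡⟨ cong₂ (λ a b → a + (suc b ∸ suc h)) (length-∷ʳ P f) m≡2t+1 ⟩
            suc (length P) + (suc (t + t) ∸ h) ≡⟨ cong (λ a → suc (length P) + (suc (t + t) ∸ a)) h≡t+1 ⟩
            suc (length P) + (t + t ∸ t)       ≡⟨ cong (λ a → suc (length P) + a) (m+n∸n≡m t t) ⟩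
            suc (length P) + t                 ≡⟨ +-suc (length P) t ⟨
            length P + suc t                   ∎)
            where open ≤-Reasoning
          finish : ∀ {Q} → length Q < length P → Shape (ρ f) s Q ⊎ (∃ λ Q′ → Shape f s Q′ × length Q′ < length Q) →
                   ∃ λ Q → (Shape (ρ f) s Q ⊎ Shape f s Q) × length Q < length P
          finish Q<P (inj₁ shape)             = _ , inj₁ shape , Q<P
          finish Q<P (inj₂ (Q′ , shape , Q′<Q)) = Q′ , inj₂ shape , <-trans Q′<Q Q<P

        module Reach (e : O) where
          open Centred e

          Shapes : V → List O → Set
          Shapes s P = Shape e s P ⊎ Shape (ρ e) s P

          in-balls : ∀ {s} P → Shapes s P → length P ≤ t → ∃ λ a → a ∈ balls × start a ≡ s
          in-balls P (inj₁ (p , r)) P≤t =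
            inj₁ P , ∈-++⁺ˡ (∈-map⁺ inj₁ (Bₑ.∈-ball⁺ t P (subst (λ u → IsWalk u (ι e) P) (sym (Bₑ.start-IsWalk P p)) p , r) P≤t)) ,
            Bₑ.start-IsWalk P p
          in-balls P (inj₂ (p , r)) P≤t =
            inj₂ P ,
            ∈-++⁺ʳ (map inj₁ (Bₑ.ball t)) (∈-map⁺ inj₂ (Bᵣ.∈-ball⁺ t P (subst (λ u → IsWalk u (ι (ρ e)) P) (sym (Bᵣ.start-IsWalk P p)) p , r) P≤t)) ,
            Bᵣ.start-IsWalk P p

          shorten′ : ∀ {s} P → Shapes s P → suc t ≤ length P → ∃ λ Q → Shapes s Q × length Q < length P
          shorten′ P (inj₁ shape) t<P = let Q , shape′ , Q<P = shorten e P shape t<P in Q , Sum.swap shape′ , Q<P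
          shorten′ P (inj₂ shape) t<P = let Q , shape′ , Q<P = shorten (ρ e) P shape t<P in
            Q , Sum.map₁ (subst (λ f → Shape f _ Q) (rev-involutive e)) shape′ , Q<P

          reach′ : ∀ n {s} P → Shapes s P → length P ≤ n → ∃ λ a → a ∈ balls × start a ≡ s
          reach′ n P shape P≤n with length P ≤? t
          ... | yes P≤t = in-balls P shape P≤t
          reach′ zero    P shape P≤n | no P≰t = contradiction (≤-trans P≤n z≤n) P≰t
          reach′ (suc n) P shape P≤n | no P≰t =
            let Q , shape′ , Q<P = shorten′ P shape (≰⇒> P≰t) in reach′ n Q shape′ (≤-pred (≤-trans Q<P P≤n))

          reach : Connected G → ∀ s → ∃ λ a → a ∈ balls × start a ≡ s
          reach conn s = let Q , q , r = connected⇒reducedWalk conn s (τ e) in from-shape (classify e Q q r)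
            where
            from-shape : ∀ {Q} → Shape (ρ e) s Q ⊎ (∃ λ Q′ → Shape e s Q′ × length Q′ < length Q) → ∃ λ a → a ∈ balls × start a ≡ s
            from-shape {Q} (inj₁ shape)           = reach′ (length Q) Q (inj₂ shape) ≤-refl
            from-shape (inj₂ (Q′ , shape , _)) = reach′ (length Q′) Q′ (inj₁ shape) ≤-refl

      closable⇒moore : Closable → Connected G → ∀ {d} → IsRegular G d → nV G ≡ mooreCount d (suc m)
      closable⇒moore close conn regular =
        trans (≤-antisym (surjectiveOn⇒≤length start balls (reach conn)) length-balls≤n) (length-balls≡moore regular)
        where
        open Centred baseEdge
        open Reach close baseEdge

    attains⇒moore : ∀ {d} → Connected G → IsMaxDegree G d → Attains d → IsMooreGraph G
    attains⇒moore {d} conn maxDeg attained = conn , d , suc m , regular , gir , count (parity m)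
      where
      open Attained maxDeg attained
      count : (∃ λ t → m ≡ t + t) ⊎ (∃ λ t → m ≡ suc (t + t)) → nV G ≡ mooreCount d (suc m)
      count (inj₁ (t , m≡)) = OddGirth.closable⇒moore t m≡ closable conn regular
      count (inj₂ (t , m≡)) = EvenGirth.closable⇒moore t m≡ closable conn regular

    moore⇒attains : ∀ {d} → IsMaxDegree G d → IsMooreGraph G → Attains d
    moore⇒attains {d} (_ , v , deg≡d) (_ , d′ , g′ , regular′ , gir′ , count′) =
      all-arcs⇒attains regular (all-arcs (parity m))
      where
      d′≡d : d′ ≡ d
      d′≡d = trans (sym (regular′ v)) deg≡d
      regular : IsRegular G d
      regular u = trans (regular′ u) d′≡d
      count : nV G ≡ mooreCount d (suc m)
      count = trans count′ (cong₂ mooreCount d′≡d (IsGirth-unique gir′ gir))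
      all-arcs : (∃ λ t → m ≡ t + t) ⊎ (∃ λ t → m ≡ suc (t + t)) → ∀ {W} → W ∈ reducedWalks h → IsArc W
      all-arcs (inj₁ (t , m≡)) = OddGirth.moore⇒all-arcs t m≡ regular count
      all-arcs (inj₂ (t , m≡)) = EvenGirth.moore⇒all-arcs t m≡ regular count

theorem1p1 : (G : Graph) (d g k : ℕ)
    → Connected G → IsMaxDegree G d → IsGirth G g → IsKissingNumber G g k
    → (g * k ≤ nV G * d * (d ∸ 1) ^ ⌊ g /2⌋)
    × ((g * k ≡ nV G * d * (d ∸ 1) ^ ⌊ g /2⌋) ⇔ IsMooreGraph G)
theorem1p1 G d zero    k conn maxDeg (() , _) kiss
theorem1p1 G d (suc m) k conn maxDeg gir       kiss =
  kissing-bound (proj₁ maxDeg) , mk⇔ (attains⇒moore conn maxDeg) (moore⇒attains maxDeg)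
  where open Kissing G m gir kiss
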